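{- Let $n\ge 1$. If $n$ is odd, then for every partition $\lambda$ of $n$ other than $(n)$ and $(1,1,\dots,1)$ there exists an almost cyclic permutation $\sigma$ of $\{1,\dots,n\}$ with $\Gamma(P(\sigma))=\lambda$. If $n$ is even, then for every partition $\lambda$ of $n$ other than $(n)$, $(1,1,\dots,1)$ and $(\frac n2,\frac n2)$ there exists an almost cyclic permutation $\sigma$ of $\{1,\dots,n\}$ with $\Gamma(P(\sigma))=\lambda$.
   Context: A permutation of $\{1,\dots,n\}$ is almost cyclic if its cycle type is $(n-1,1)$, i.e. it consists of one cycle of length $n-1$ and one fixed point. Permutations are written as sequences $\sigma=(\sigma_1,\dots,\sigma_n)$. For a finite sequence $\sigma$ of distinct integers, $P(\sigma)$ is the Robinson--Schensted--Knuth insertion tableau obtained by inserting $\sigma_1,\sigma_2,\dots$ in order by Schensted row insertion (to insert $a$ into row $r$: if row $r$ is empty or $a$ exceeds every entry of row $r$, append $a$ and stop; otherwise replace the leftmost entry $b>a$ of row $r$ by $a$ and insert $b$ into row $r+1$). $\Gamma(P(\sigma))$ is the shape of $P(\sigma)$, its row lengths in nonincreasing order. -}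

module Defs where

open import Data.Nat using (ℕ; zero; suc; _<_; _≥_; _≤ᵇ_; _+_)
open import Data.Bool using (true; false; if_then_else_)
open import Data.List using (List; []; _∷_; map; length; foldl)
open import Data.Nat.ListAction using (sum)
open import Data.List.Relation.Unary.All using (All)
open import Data.List.Relation.Unary.Linked using (Linked)
open import Data.Maybe using (Maybe; just; nothing)
open import Data.Product using (_×_; _,_; ∃)
open import Data.Fin using (Fin; toℕ)
open import Data.Fin.Permutation using (Permutation′; _⟨$⟩ʳ_)
open import Data.List using (allFin)
open import Relation.Binary.PropositionalEquality using (_≡_; _≢_)

iter : ∀ {n} → Permutation′ n → ℕ → Fin n → Fin n
iter σ zero    x = x
iter σ (suc k) x = σ ⟨$⟩ʳ (iter σ k x)

-- cycle type (n-1,1): a fixed point f, and all other points form one cycle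
-- (any j ≠ f reaches any k ≠ f under iteration of σ)
AlmostCyclic : ∀ {n} → Permutation′ n → Set
AlmostCyclic {n} σ =
  ∃ λ (f : Fin n) → (σ ⟨$⟩ʳ f ≡ f) ×
    (∀ (j k : Fin n) → j ≢ f → k ≢ f → ∃ λ m → iter σ m j ≡ k)

IsPartition : ℕ → List ℕ → Set
IsPartition n λ′ = All (λ p → 1 ≤ p) λ′ × Linked (λ a b → b ≤ a) λ′ × sum λ′ ≡ n
  where open Data.Nat using (_≤_)

insertRow : ℕ → List ℕ → List ℕ × Maybe ℕ
insertRow a []       = a ∷ [] , nothing
insertRow a (b ∷ bs) with suc a ≤ᵇ b
... | true  = a ∷ bs , just b
... | false with insertRow a bs
...   | bs′ , r = b ∷ bs′ , r

-- insertion of a into a tableau (list of rows, top row first)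
insertTab : ℕ → List (List ℕ) → List (List ℕ)
insertTab a []         = (a ∷ []) ∷ []
insertTab a (row ∷ rs) with insertRow a row
... | row′ , nothing = row′ ∷ rs
... | row′ , just b  = row′ ∷ insertTab b rs

P : List ℕ → List (List ℕ)
P = foldl (λ t a → insertTab a t) []

Γ : List (List ℕ) → List ℕ
Γ = map length

oneLine : ∀ {n} → Permutation′ n → List ℕ
oneLine {n} σ = map (λ i → suc (toℕ (σ ⟨$⟩ʳ i))) (allFin n)

module Submission where

-- Describe λ′ by its column heights c = conjugate λ′ and build a word on 0, …, n − 1 column by column:
-- column j is an interval of consecutive values, and its entries are arranged so that Schensted insertion
-- stacks each interval into one column of P, giving P the columns c and hence the shape λ′. Inside the
-- segment of a column the map i ↦ W(i) is a reflection, so the edges i — W(i) zigzag through the whole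
-- column and on into the next one. Splitting the first column (or choosing the tail) so that exactly one
-- position is fixed makes the functional graph of W one cycle of length n − 1 plus a fixed point. This needs
-- a column of height ≥ 3 next to another column, or columns of heights 2 and 1, which fails exactly for
-- (n), (1ⁿ) and (n/2, n/2).

open import Defs
open import Data.Bool using (true; false; T)
open import Data.Empty using (⊥; ⊥-elim)
open import Data.Fin using (Fin; toℕ; fromℕ<)
open import Data.Fin.Permutation using (Permutation′; permutation; _⟨$⟩ʳ_; _⟨$⟩ˡ_; inverseˡ)
open import Data.Fin.Properties using (toℕ-fromℕ<; toℕ-injective; toℕ<n; fromℕ<-toℕ; pigeonhole)
open import Data.List
  using (List; []; _∷_; _++_; map; length; foldl; foldr; replicate; concat; applyUpTo; fromMaybe; upTo; tabulate; allFin)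
import Data.List.Properties as List
open import Data.List.Membership.Propositional using (_∈_)
open import Data.List.Membership.Propositional.Properties using (∈-upTo⁻; ∈-upTo⁺)
open import Data.List.Relation.Binary.Permutation.Propositional
  using (_↭_; ↭-sym; ↭⇒↭ₛ; ↭-refl; ↭-trans; ↭-reflexive; prep; swap; module PermutationReasoning)
open import Data.List.Relation.Binary.Permutation.Propositional.Properties
  using (∈-resp-↭; ↭-length; shift; shifts; ++⁺ˡ; ++⁺ʳ; ++-comm)
import Data.List.Relation.Binary.Permutation.Setoid.Properties as Permutationₛ
open import Data.List.Relation.Unary.All using (All; []; _∷_)
import Data.List.Relation.Unary.All as All
open import Data.List.Relation.Unary.All.Properties using (++⁻ˡ; replicate⁺)
open import Data.List.Relation.Unary.AllPairs using (_∷_)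
open import Data.List.Relation.Unary.Any using (here; there)
open import Data.List.Relation.Unary.Linked using (Linked; []; [-]; _∷_)
import Data.List.Relation.Unary.Linked as Linked
open import Data.List.Relation.Unary.Linked.Properties using (Linked⇒All)
open import Data.List.Relation.Unary.Unique.Propositional using (Unique)
open import Data.List.Relation.Unary.Unique.Propositional.Properties using (upTo⁺)
open import Data.Maybe using (Maybe; just; nothing)
import Data.Maybe.Relation.Unary.All as Maybe
open import Data.Nat
open import Data.Nat.ListAction using (sum)
open import Data.Nat.Properties
open import Data.Nat.Tactic.RingSolver using (solve-∀)
open import Data.Product using (Σ; ∃; _×_; _,_; proj₁; proj₂)
open import Data.Sum using (_⊎_; inj₁; inj₂)
open import Data.Unit using (⊤; tt)
open import Relation.Binary.PropositionalEquality
open import Relation.Nullary using (¬_; yes; no)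

-- Tableaux built from columns

Tableau : Set
Tableau = List (List ℕ)

insertRow-bump : ∀ {v b} bs → v < b → insertRow v (b ∷ bs) ≡ (v ∷ bs , just b)
insertRow-bump {v} {b} bs v<b with suc v ≤ᵇ b | ≤⇒≤ᵇ v<b
... | true | _ = refl

insertRow-pass : ∀ {v b} bs → b ≤ v →
  insertRow v (b ∷ bs) ≡ (b ∷ proj₁ (insertRow v bs) , proj₂ (insertRow v bs))
insertRow-pass {v} {b} bs b≤v with suc v ≤ᵇ b in eq
... | false = refl
... | true  = ⊥-elim (<⇒≱ (≤ᵇ⇒≤ (suc v) b (subst T (sym eq) tt)) b≤v)

insertRow-bumped : ∀ {P : ℕ → Set} v r → All P r → Maybe.All P (proj₂ (insertRow v r))
insertRow-bumped v []       []         = Maybe.nothing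
insertRow-bumped v (b ∷ bs) (pb ∷ pbs) with suc v ≤ᵇ b
... | true  = Maybe.just pb
... | false with insertRow v bs | insertRow-bumped v bs pbs
...   | _ , _ | bumped = bumped

insertBumped : Maybe ℕ → Tableau → Tableau
insertBumped nothing  rs = rs
insertBumped (just b) rs = insertTab b rs

insertTab-∷ : ∀ a row rs →
  insertTab a (row ∷ rs) ≡ proj₁ (insertRow a row) ∷ insertBumped (proj₂ (insertRow a row)) rs
insertTab-∷ a row rs with insertRow a row
... | _ , nothing = refl
... | _ , just _  = refl

-- attachColumn C rs puts the column C (read top to bottom) in front of the rows rs.
attachColumn : List ℕ → Tableau → Tableau
attachColumn []       rs       = rs
attachColumn (c ∷ cs) []       = (c ∷ []) ∷ attachColumn cs []
attachColumn (c ∷ cs) (r ∷ rs) = (c ∷ r) ∷ attachColumn cs rs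

fromColumns : List (List ℕ) → Tableau
fromColumns = foldr attachColumn []

insertTab-onto-column : ∀ v C rs → Linked _<_ (v ∷ C) → length rs ≤ length C →
  insertTab v (attachColumn C rs) ≡ attachColumn (v ∷ C) rs
insertTab-onto-column v []       []       _           _ = refl
insertTab-onto-column v (c ∷ cs) []       (v<c ∷ c∷cs) _
  rewrite insertTab-∷ v (c ∷ []) (attachColumn cs []) | insertRow-bump [] v<c
  = cong ((v ∷ []) ∷_) (insertTab-onto-column c cs [] c∷cs z≤n)
insertTab-onto-column v (c ∷ cs) (r ∷ rs) (v<c ∷ c∷cs) (s≤s len)
  rewrite insertTab-∷ v (c ∷ r) (attachColumn cs rs) | insertRow-bump r v<c
  = cong ((v ∷ r) ∷_) (insertTab-onto-column c cs rs c∷cs len)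

insertTab-past-column : ∀ β v C rs → All (_< β) C → β ≤ v → All (All (β ≤_)) rs →
  insertTab v (attachColumn C rs) ≡ attachColumn C (insertTab v rs)
insertTab-past-column β v []       rs       _            _   _ = refl
insertTab-past-column β v (c ∷ cs) []       (c<β ∷ _)    β≤v _
  rewrite insertTab-∷ v (c ∷ []) (attachColumn cs [])
        | insertRow-pass {v} {c} [] (<⇒≤ (<-≤-trans c<β β≤v)) = refl
insertTab-past-column β v (c ∷ cs) (r ∷ rs) (c<β ∷ cs<β) β≤v (β≤r ∷ β≤rs)
  rewrite insertTab-∷ v (c ∷ r) (attachColumn cs rs)
        | insertRow-pass {v} {c} r (<⇒≤ (<-≤-trans c<β β≤v))
        | insertTab-∷ v r rs
  = cong ((c ∷ proj₁ (insertRow v r)) ∷_) (past (insertRow-bumped v r β≤r))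
  where
    past : ∀ {m} → Maybe.All (β ≤_) m →
      insertBumped m (attachColumn cs rs) ≡ attachColumn cs (insertBumped m rs)
    past Maybe.nothing       = refl
    past (Maybe.just β≤b) = insertTab-past-column β _ cs rs cs<β β≤b β≤rs

All-attachColumn : ∀ {P : ℕ → Set} C rs → All P C → All (All P) rs → All (All P) (attachColumn C rs)
All-attachColumn []       rs       _          prs        = prs
All-attachColumn (c ∷ cs) []       (pc ∷ pcs) []         = (pc ∷ []) ∷ All-attachColumn cs [] pcs []
All-attachColumn (c ∷ cs) (r ∷ rs) (pc ∷ pcs) (pr ∷ prs) = (pc ∷ pr) ∷ All-attachColumn cs rs pcs prs

All-foldr-attachColumn : ∀ {P : ℕ → Set} F R → All (All P) F → All (All P) R →
  All (All P) (foldr attachColumn R F)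
All-foldr-attachColumn []      R _          pR = pR
All-foldr-attachColumn (C ∷ F) R (pC ∷ pF) pR =
  All-attachColumn C (foldr attachColumn R F) pC (All-foldr-attachColumn F R pF pR)

-- Stacked lo F hi: the columns F occupy consecutive value ranges [lo, m₁), [m₁, m₂), … inside [lo, hi).
data Stacked : ℕ → List (List ℕ) → ℕ → Set where
  []  : ∀ {lo hi} → lo ≤ hi → Stacked lo [] hi
  _∷_ : ∀ {lo hi C F m} → lo ≤ m × All (λ x → lo ≤ x × x < m) C → Stacked m F hi → Stacked lo (C ∷ F) hi

Stacked-≤ : ∀ {lo F hi} → Stacked lo F hi → lo ≤ hi
Stacked-≤ ([] lo≤hi)         = lo≤hi
Stacked-≤ ((lo≤m , _) ∷ st) = ≤-trans lo≤m (Stacked-≤ st)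

Stacked-lower : ∀ {lo F hi} → Stacked lo F hi → All (All (lo ≤_)) F
Stacked-lower ([] _)               = []
Stacked-lower ((lo≤m , inC) ∷ st) =
  All.map proj₁ inC ∷ All.map (All.map (≤-trans lo≤m)) (Stacked-lower st)

insertTab-past-columns : ∀ {lo} β v F R → Stacked lo F β → β ≤ v → All (All (β ≤_)) R →
  insertTab v (foldr attachColumn R F) ≡ foldr attachColumn (insertTab v R) F
insertTab-past-columns β v []      R _                   _   _   = refl
insertTab-past-columns β v (C ∷ F) R ((_ , inC) ∷ st) β≤v β≤R =
  trans (insertTab-past-column _ v C (foldr attachColumn R F) (All.map proj₂ inC) (≤-trans m≤β β≤v)
          (All-foldr-attachColumn F R (Stacked-lower st) (All.map (All.map (≤-trans m≤β)) β≤R)))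
        (cong (attachColumn C) (insertTab-past-columns β v F R st β≤v β≤R))
  where m≤β = Stacked-≤ st

-- Conjugate shapes

addColumnToShape : ℕ → List ℕ → List ℕ
addColumnToShape zero    ν       = ν
addColumnToShape (suc k) []      = 1 ∷ addColumnToShape k []
addColumnToShape (suc k) (l ∷ ν) = suc l ∷ addColumnToShape k ν

conjugate : List ℕ → List ℕ
conjugate = foldr addColumnToShape []

shape-attachColumn : ∀ C rs → Γ (attachColumn C rs) ≡ addColumnToShape (length C) (Γ rs)
shape-attachColumn []       rs       = refl
shape-attachColumn (c ∷ cs) []       = cong (1 ∷_) (shape-attachColumn cs [])
shape-attachColumn (c ∷ cs) (r ∷ rs) = cong (suc (length r) ∷_) (shape-attachColumn cs rs)

shape-fromColumns : ∀ cols → Γ (fromColumns cols) ≡ conjugate (map length cols)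
shape-fromColumns []         = refl
shape-fromColumns (C ∷ cols) =
  trans (shape-attachColumn C (fromColumns cols)) (cong (addColumnToShape (length C)) (shape-fromColumns cols))

addColumnToShape-≤ : ∀ k ν → length ν ≤ k → addColumnToShape k ν ≡ map suc ν ++ replicate (k ∸ length ν) 1
addColumnToShape-≤ zero    []      _         = refl
addColumnToShape-≤ (suc k) []      _         = cong (1 ∷_) (addColumnToShape-≤ k [] z≤n)
addColumnToShape-≤ (suc k) (l ∷ ν) (s≤s len) = cong (suc l ∷_) (addColumnToShape-≤ k ν len)

length-addColumnToShape : ∀ k ν → length ν ≤ k → length (addColumnToShape k ν) ≡ k
length-addColumnToShape zero    []      _         = refl
length-addColumnToShape (suc k) []      _         = cong suc (length-addColumnToShape k [] z≤n)
length-addColumnToShape (suc k) (l ∷ ν) (s≤s len) = cong suc (length-addColumnToShape k ν len)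

conjugate-replicate-1 : ∀ d → conjugate (replicate (suc d) 1) ≡ suc d ∷ []
conjugate-replicate-1 zero    = refl
conjugate-replicate-1 (suc d) rewrite conjugate-replicate-1 d = refl

conjugate-replicate-2 : ∀ t → conjugate (replicate (suc t) 2) ≡ suc t ∷ suc t ∷ []
conjugate-replicate-2 zero    = refl
conjugate-replicate-2 (suc t) rewrite conjugate-replicate-2 t = refl

conjugate-[_] : ∀ x → conjugate (x ∷ []) ≡ replicate x 1
conjugate-[ zero  ] = refl
conjugate-[ suc x ] = cong (1 ∷_) conjugate-[ x ]

conjugate-suc : ∀ ν d → 1 ≤ length ν + d →
  conjugate (map suc ν ++ replicate d 1) ≡ (length ν + d) ∷ conjugate ν
conjugate-suc []          (suc d) _ = conjugate-replicate-1 d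
conjugate-suc (a ∷ [])    zero    _ = refl
conjugate-suc (a ∷ [])    (suc d) _ rewrite conjugate-replicate-1 d = refl
conjugate-suc (a ∷ b ∷ ν) d       _ rewrite conjugate-suc (b ∷ ν) d (s≤s z≤n) = refl

Nonincreasing : List ℕ → Set
Nonincreasing = Linked (λ a b → b ≤ a)

Nonincreasing-All : ∀ {x xs} → Nonincreasing (x ∷ xs) → All (_≤ x) xs
Nonincreasing-All [-]         = []
Nonincreasing-All (y≤x ∷ ni) = Linked⇒All (λ p q → ≤-trans q p) y≤x ni

Nonincreasing-∷ : ∀ {x xs} → All (_≤ x) xs → Nonincreasing xs → Nonincreasing (x ∷ xs)
Nonincreasing-∷ []          _  = [-]
Nonincreasing-∷ (y≤x ∷ _) ni = y≤x ∷ ni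

length-conjugate : ∀ l ls → Nonincreasing (l ∷ ls) → length (conjugate (l ∷ ls)) ≡ l
length-conjugate l []       _          = length-addColumnToShape l [] z≤n
length-conjugate l (m ∷ ls) (m≤l ∷ ni) =
  length-addColumnToShape l (conjugate (m ∷ ls)) (subst (_≤ l) (sym (length-conjugate m ls ni)) m≤l)

length-conjugate-tail-≤ : ∀ l ls → Nonincreasing (l ∷ ls) → length (conjugate ls) ≤ l
length-conjugate-tail-≤ l []       _          = z≤n
length-conjugate-tail-≤ l (m ∷ ls) (m≤l ∷ ni) = subst (_≤ l) (sym (length-conjugate m ls ni)) m≤l

conjugate-involutive : ∀ λ′ → All (1 ≤_) λ′ → Nonincreasing λ′ → conjugate (conjugate λ′) ≡ λ′
conjugate-involutive []       _            _  = refl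
conjugate-involutive (l ∷ ls) (1≤l ∷ pos) ni = begin
  conjugate (addColumnToShape l ν)                       ≡⟨ cong conjugate (addColumnToShape-≤ l ν ν≤l) ⟩
  conjugate (map suc ν ++ replicate (l ∸ length ν) 1)    ≡⟨ conjugate-suc ν (l ∸ length ν) 1≤ ⟩
  (length ν + (l ∸ length ν)) ∷ conjugate ν              ≡⟨ cong₂ _∷_ (m+[n∸m]≡n ν≤l) ih ⟩
  l ∷ ls                                                 ∎
  where
    open ≡-Reasoning
    ν = conjugate ls
    ν≤l : length ν ≤ l
    ν≤l = length-conjugate-tail-≤ l ls ni
    1≤ : 1 ≤ length ν + (l ∸ length ν)
    1≤ = subst (1 ≤_) (sym (m+[n∸m]≡n ν≤l)) 1≤l
    ih : conjugate ν ≡ ls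
    ih = conjugate-involutive ls pos (Linked.tail ni)

sum-addColumnToShape : ∀ k ν → sum (addColumnToShape k ν) ≡ k + sum ν
sum-addColumnToShape zero    ν       = refl
sum-addColumnToShape (suc k) []      = cong suc (sum-addColumnToShape k [])
sum-addColumnToShape (suc k) (l ∷ ν) = cong suc (begin
  l + sum (addColumnToShape k ν) ≡⟨ cong (l +_) (sum-addColumnToShape k ν) ⟩
  l + (k + sum ν)                ≡⟨ x+[y+z]≡y+[x+z] l k (sum ν) ⟩
  k + (l + sum ν)                ∎)
  where
    open ≡-Reasoning
    x+[y+z]≡y+[x+z] : ∀ x y z → x + (y + z) ≡ y + (x + z)
    x+[y+z]≡y+[x+z] = solve-∀

sum-conjugate : ∀ λ′ → sum (conjugate λ′) ≡ sum λ′
sum-conjugate []       = refl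
sum-conjugate (l ∷ ls) = trans (sum-addColumnToShape l (conjugate ls)) (cong (l +_) (sum-conjugate ls))

positive-addColumnToShape : ∀ k ν → All (1 ≤_) ν → All (1 ≤_) (addColumnToShape k ν)
positive-addColumnToShape zero    ν       pos       = pos
positive-addColumnToShape (suc k) []      _         = s≤s z≤n ∷ positive-addColumnToShape k [] []
positive-addColumnToShape (suc k) (l ∷ ν) (_ ∷ pos) = s≤s z≤n ∷ positive-addColumnToShape k ν pos

positive-conjugate : ∀ λ′ → All (1 ≤_) (conjugate λ′)
positive-conjugate []       = []
positive-conjugate (l ∷ ls) = positive-addColumnToShape l (conjugate ls) (positive-conjugate ls)

addColumnToShape-bounded : ∀ k l ν → All (_≤ l) ν → All (_≤ suc l) (addColumnToShape k ν)
addColumnToShape-bounded zero    l ν       ν≤l          = All.map m≤n⇒m≤1+n ν≤l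
addColumnToShape-bounded (suc k) l []      _            = s≤s z≤n ∷ addColumnToShape-bounded k l [] []
addColumnToShape-bounded (suc k) l (m ∷ ν) (m≤l ∷ ν≤l) = s≤s m≤l ∷ addColumnToShape-bounded k l ν ν≤l

Nonincreasing-addColumnToShape : ∀ k ν → Nonincreasing ν → Nonincreasing (addColumnToShape k ν)
Nonincreasing-addColumnToShape zero    ν       ni = ni
Nonincreasing-addColumnToShape (suc k) []      _  =
  Nonincreasing-∷ (addColumnToShape-bounded k 0 [] []) (Nonincreasing-addColumnToShape k [] [])
Nonincreasing-addColumnToShape (suc k) (l ∷ ν) ni =
  Nonincreasing-∷ (addColumnToShape-bounded k l ν (Nonincreasing-All ni))
                  (Nonincreasing-addColumnToShape k ν (Linked.tail ni))

Nonincreasing-conjugate : ∀ λ′ → Nonincreasing (conjugate λ′)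
Nonincreasing-conjugate []       = []
Nonincreasing-conjugate (l ∷ ls) = Nonincreasing-addColumnToShape l (conjugate ls) (Nonincreasing-conjugate ls)

-- The permutation with one-line notation W

-- nth W i is the entry of W at position i (counting from 0); 0 is a junk value past the end.
nth : List ℕ → ℕ → ℕ
nth []       _       = 0
nth (x ∷ xs) zero    = x
nth (x ∷ xs) (suc i) = nth xs i

nth-∈ : ∀ W i → i < length W → nth W i ∈ W
nth-∈ (x ∷ W) zero    _         = here refl
nth-∈ (x ∷ W) (suc i) (s≤s i<) = there (nth-∈ W i i<)

position : ∀ {x} W → x ∈ W → Σ ℕ λ i → i < length W × nth W i ≡ x
position (y ∷ W) (here refl) = 0 , s≤s z≤n , refl
position (y ∷ W) (there x∈W) with position W x∈W
... | i , i< , eq = suc i , s≤s i< , eq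

nth-injective : ∀ W i j → Unique W → i < length W → j < length W → nth W i ≡ nth W j → i ≡ j
nth-injective (x ∷ W) zero    zero    _            _         _         _  = refl
nth-injective (x ∷ W) zero    (suc j) (x∉W ∷ _)   _         (s≤s j<) eq = ⊥-elim (All.lookup x∉W (nth-∈ W j j<) eq)
nth-injective (x ∷ W) (suc i) zero    (x∉W ∷ _)   (s≤s i<) _         eq = ⊥-elim (All.lookup x∉W (nth-∈ W i i<) (sym eq))
nth-injective (x ∷ W) (suc i) (suc j) (_ ∷ uniq) (s≤s i<) (s≤s j<) eq = cong suc (nth-injective W i j uniq i< j< eq)

module _ {n : ℕ} {W : List ℕ} (W↭ : W ↭ upTo n) where

  length-word : length W ≡ n
  length-word = trans (↭-length W↭) (List.length-upTo n)

  private
    unique : Unique W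
    unique = Permutationₛ.Unique-resp-↭ (setoid ℕ) (↭⇒↭ₛ (↭-sym W↭)) (upTo⁺ n)

    toLength : ∀ {i} → i < n → i < length W
    toLength = subst (_ <_) (sym length-word)

  nth-word-< : ∀ {i} → i < n → nth W i < n
  nth-word-< i< = ∈-upTo⁻ (∈-resp-↭ W↭ (nth-∈ W _ (toLength i<)))

  private
    index : (v : Fin n) → Σ ℕ λ i → i < length W × nth W i ≡ toℕ v
    index v = position W (∈-resp-↭ (↭-sym W↭) (∈-upTo⁺ (toℕ<n v)))

    to from : Fin n → Fin n
    to   i = fromℕ< (nth-word-< (toℕ<n i))
    from v = fromℕ< (subst (proj₁ (index v) <_) length-word (proj₁ (proj₂ (index v))))

    to-from : ∀ v → to (from v) ≡ v
    to-from v = toℕ-injective (begin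
      toℕ (to (from v))           ≡⟨ toℕ-fromℕ< _ ⟩
      nth W (toℕ (from v))        ≡⟨ cong (nth W) (toℕ-fromℕ< _) ⟩
      nth W (proj₁ (index v))     ≡⟨ proj₂ (proj₂ (index v)) ⟩
      toℕ v                       ∎)
      where open ≡-Reasoning

    from-to : ∀ i → from (to i) ≡ i
    from-to i = toℕ-injective (trans (toℕ-fromℕ< _)
      (nth-injective W _ _ unique (proj₁ (proj₂ (index (to i)))) (toLength (toℕ<n i))
        (trans (proj₂ (proj₂ (index (to i)))) (toℕ-fromℕ< _))))

  wordPermutation : Permutation′ n
  wordPermutation = permutation to from to-from from-to

  wordPermutation-nth : ∀ i → toℕ (wordPermutation ⟨$⟩ʳ i) ≡ nth W (toℕ i)
  wordPermutation-nth i = toℕ-fromℕ< _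

  wordPermutation-fromℕ< : ∀ {p q} (p< : p < n) (q< : q < n) → nth W p ≡ q →
    wordPermutation ⟨$⟩ʳ fromℕ< p< ≡ fromℕ< q<
  wordPermutation-fromℕ< {p} {q} p< q< eq = toℕ-injective (begin
    toℕ (wordPermutation ⟨$⟩ʳ fromℕ< p<)  ≡⟨ wordPermutation-nth (fromℕ< p<) ⟩
    nth W (toℕ (fromℕ< p<))              ≡⟨ cong (nth W) (toℕ-fromℕ< p<) ⟩
    nth W p                              ≡⟨ eq ⟩
    q                                    ≡⟨ toℕ-fromℕ< q< ⟨
    toℕ (fromℕ< q<)                      ∎)
    where open ≡-Reasoning

  oneLine-wordPermutation : oneLine wordPermutation ≡ map suc W
  oneLine-wordPermutation = begin
    map (λ i → suc (toℕ (wordPermutation ⟨$⟩ʳ i))) (allFin n)  ≡⟨ List.map-tabulate (λ i → i) _ ⟩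
    tabulate (λ i → suc (toℕ (wordPermutation ⟨$⟩ʳ i)))        ≡⟨ List.tabulate-cong (λ i → cong suc (wordPermutation-nth i)) ⟩
    tabulate (λ i → suc (nth W (toℕ i)))                       ≡⟨ tabulate-nth n W length-word ⟩
    map suc W                                                  ∎
    where
      open ≡-Reasoning
      tabulate-nth : ∀ m V → length V ≡ m → tabulate {n = m} (λ i → suc (nth V (toℕ i))) ≡ map suc V
      tabulate-nth zero    []      _  = refl
      tabulate-nth (suc m) (x ∷ V) eq = cong (suc x ∷_) (tabulate-nth m V (suc-injective eq))

module _ {n : ℕ} (σ : Permutation′ n) where

  iter-+ : ∀ m k x → iter σ (m + k) x ≡ iter σ m (iter σ k x)
  iter-+ zero    k x = refl
  iter-+ (suc m) k x = cong (σ ⟨$⟩ʳ_) (iter-+ m k x)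

  iter-injective : ∀ m {x y} → iter σ m x ≡ iter σ m y → x ≡ y
  iter-injective zero    eq = eq
  iter-injective (suc m) eq = iter-injective m (trans (sym (inverseˡ σ)) (trans (cong (σ ⟨$⟩ˡ_) eq) (inverseˡ σ)))

  -- Two of x, σ x, …, σⁿ x coincide, and σ is injective.
  iter-returns : ∀ x → ∃ λ N → iter σ (suc N) x ≡ x
  iter-returns x with pigeonhole (n<1+n n) (λ (i : Fin (suc n)) → iter σ (toℕ i) x)
  ... | i , j , i<j , eq = toℕ j ∸ suc (toℕ i) , iter-injective (toℕ i) (begin
    iter σ (toℕ i) (iter σ (suc N) x)  ≡⟨ iter-+ (toℕ i) (suc N) x ⟨
    iter σ (toℕ i + suc N) x           ≡⟨ cong (λ k → iter σ k x) i+[N+1]≡j ⟩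
    iter σ (toℕ j) x                   ≡⟨ eq ⟨
    iter σ (toℕ i) x                   ∎)
    where
      open ≡-Reasoning
      N = toℕ j ∸ suc (toℕ i)
      i+[N+1]≡j : toℕ i + suc N ≡ toℕ j
      i+[N+1]≡j = trans (+-suc (toℕ i) N) (m+[n∸m]≡n i<j)

  iter-* : ∀ x N → iter σ (suc N) x ≡ x → ∀ q → iter σ (q * suc N) x ≡ x
  iter-* x N eq zero    = refl
  iter-* x N eq (suc q) = trans (iter-+ (suc N) (q * suc N) x) (trans (cong (iter σ (suc N)) (iter-* x N eq q)) eq)

  Reaches : Fin n → Fin n → Set
  Reaches x y = ∃ λ m → iter σ m x ≡ y

  Reaches-trans : ∀ {x y z} → Reaches x y → Reaches y z → Reaches x z
  Reaches-trans (m , refl) (k , refl) = k + m , iter-+ k m _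

  Reaches-sym : ∀ {x y} → Reaches x y → Reaches y x
  Reaches-sym {x} (m , refl) with iter-returns x
  ... | N , eq = N * m , (begin
    iter σ (N * m) (iter σ m x)  ≡⟨ iter-+ (N * m) m x ⟨
    iter σ (N * m + m) x         ≡⟨ cong (λ k → iter σ k x) (trans (+-comm (N * m) m) (*-comm (suc N) m)) ⟩
    iter σ (m * suc N) x         ≡⟨ iter-* x N eq m ⟩
    x                            ∎)
    where open ≡-Reasoning

data Walk (W : List ℕ) : ℕ → ℕ → Set where
  done : ∀ {p} → Walk W p p
  fwd  : ∀ {p q r} → p < length W → nth W p ≡ q → Walk W q r → Walk W p r
  bwd  : ∀ {p q r} → q < length W → nth W q ≡ p → Walk W q r → Walk W p r

infixr 5 _++ʷ_

_++ʷ_ : ∀ {W p q r} → Walk W p q → Walk W q r → Walk W p r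
done          ++ʷ w′ = w′
fwd p< eq w   ++ʷ w′ = fwd p< eq (w ++ʷ w′)
bwd q< eq w   ++ʷ w′ = bwd q< eq (w ++ʷ w′)

reverseʷ : ∀ {W p q} → Walk W p q → Walk W q p
reverseʷ done          = done
reverseʷ (fwd p< eq w) = reverseʷ w ++ʷ bwd p< eq done
reverseʷ (bwd q< eq w) = reverseʷ w ++ʷ fwd q< eq done

module _ {n : ℕ} {W : List ℕ} (W↭ : W ↭ upTo n) where

  private
    σ = wordPermutation W↭

  -- In a permutation, reachability is symmetric, so undirected walks stay inside one cycle.
  Walk⇒Reaches : ∀ {p q} (p< : p < n) (q< : q < n) → Walk W p q → Reaches σ (fromℕ< p<) (fromℕ< q<)
  Walk⇒Reaches p< q< done = 0 , refl
  Walk⇒Reaches p< r< (fwd _ refl w) =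
    Reaches-trans σ (1 , wordPermutation-fromℕ< W↭ p< q< refl) (Walk⇒Reaches q< r< w)
    where q< = nth-word-< W↭ p<
  Walk⇒Reaches p< r< (bwd q<W refl w) =
    Reaches-trans σ (Reaches-sym σ (1 , wordPermutation-fromℕ< W↭ q< p< refl)) (Walk⇒Reaches q< r< w)
    where q< = subst (_ <_) (length-word W↭) q<W

  wordPermutation-almostCyclic : ∀ {f b} → f < n → nth W f ≡ f →
    (∀ p → p < n → p ≢ f → Walk W p b) → AlmostCyclic σ
  wordPermutation-almostCyclic {f} f< fixed walk =
    fromℕ< f< , wordPermutation-fromℕ< W↭ f< f< fixed , λ j k j≢f k≢f →
      subst₂ (Reaches σ) (fromℕ<-toℕ j (toℕ<n j)) (fromℕ<-toℕ k (toℕ<n k))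
        (Walk⇒Reaches (toℕ<n j) (toℕ<n k) (walkFrom j j≢f ++ʷ reverseʷ (walkFrom k k≢f)))
    where
      walkFrom : ∀ j → j ≢ fromℕ< f< → Walk W (toℕ j) _
      walkFrom j j≢f = walk (toℕ j) (toℕ<n j) (λ eq → j≢f (toℕ-injective (trans eq (sym (toℕ-fromℕ< f<)))))

-- The word

up : ℕ → ℕ → List ℕ
up β zero    = []
up β (suc l) = β ∷ up (suc β) l

length-up : ∀ β l → length (up β l) ≡ l
length-up β zero    = refl
length-up β (suc l) = cong suc (length-up (suc β) l)

down : ℕ → ℕ → List ℕ
down β zero    = []
down β (suc l) = β + l ∷ down β l

-- The word is assembled column by column; column j is an interval of values [oⱼ, oⱼ + hⱼ).
-- A column of height a + b + 2 that is not the last one is a block (a , b); the last columns form a tail: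
-- column u v is one column of height u + v + 1, singletons r and singletonsFixed r are r + 1 and r + 2
-- columns of height 1, and twoOne is a column of height 2 followed by one of height 1.
Block : Set
Block = ℕ × ℕ

height : Block → ℕ
height (a , b) = suc (suc (a + b))

data Tail : Set where
  column          : ℕ → ℕ → Tail
  singletons      : ℕ → Tail
  singletonsFixed : ℕ → Tail
  twoOne          : Tail

-- The entry of the first column of the tail starting at o that is written before the tail's own segment.
tailTop : ℕ → Tail → ℕ
tailTop o (column u v)        = o + (u + v)
tailTop o (singletons r)      = o
tailTop o (singletonsFixed r) = o
tailTop o twoOne              = suc o

topOf : ℕ → List Block → Tail → ℕ
topOf o []             tl = tailTop o tl
topOf o ((a , b) ∷ bs) tl = o + suc (a + b)

-- The segment of a block starting at o: the a entries below its top, then the top en of the next column,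
-- then the b entries above its bottom o.
blockBody : ℕ → ℕ → ℕ → ℕ → List ℕ
blockBody o a b en = down (o + suc b) a ++ en ∷ down (suc o) b

tailWord : ℕ → ℕ → Tail → List ℕ
tailWord o x (column u v)        = down (o + v) u ++ x ∷ down o v
tailWord o x (singletons r)      = up (suc o) r ++ x ∷ []
tailWord o x (singletonsFixed r) = up (suc o) r ++ x ∷ suc (o + r) ∷ []
tailWord o x twoOne              = x ∷ o ∷ suc (suc o) ∷ []

-- restWord x h bs tl continues after a column [x, x + h): each later segment starts with the bottom entry
-- x of the previous column.
restWord : ℕ → ℕ → List Block → Tail → List ℕ
restWord x h []             tl = tailWord (x + h) x tl
restWord x h ((a , b) ∷ bs) tl =
  x ∷ blockBody (x + h) a b (topOf (x + h + height (a , b)) bs tl) ++ restWord (x + h) (height (a , b)) bs tl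

word : ℕ → List Block → Tail → List ℕ
word o []             tl = tailWord o (tailTop o tl) tl
word o ((a , b) ∷ bs) tl =
  o + suc (a + b) ∷ blockBody o a b (topOf (o + height (a , b)) bs tl) ++ restWord o (height (a , b)) bs tl

insertStep : Tableau → ℕ → Tableau
insertStep T a = insertTab a T

insertWord : Tableau → List ℕ → Tableau
insertWord = foldl insertStep

-- Its insertion tableau

Stacked-weaken : ∀ {lo G β β′} → Stacked lo G β → β ≤ β′ → Stacked lo G β′
Stacked-weaken ([] lo≤β) β≤β′ = [] (≤-trans lo≤β β≤β′)
Stacked-weaken (inC ∷ st) β≤β′ = inC ∷ Stacked-weaken st β≤β′

Stacked-∷ʳ : ∀ {lo G m hi C} → Stacked lo G m → m ≤ hi → All (λ x → m ≤ x × x < hi) C → Stacked lo (G ++ C ∷ []) hi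
Stacked-∷ʳ ([] lo≤m) m≤hi inC = (≤-trans lo≤m m≤hi , All.map (λ { (p , q) → ≤-trans lo≤m p , q }) inC) ∷ [] ≤-refl
Stacked-∷ʳ (inC′ ∷ st) m≤hi inC = inC′ ∷ Stacked-∷ʳ st m≤hi inC

up-range : ∀ β l → All (λ x → β ≤ x × x < β + l) (up β l)
up-range β zero = []
up-range β (suc l) = (≤-refl , subst (β <_) (sym (+-suc β l)) (s≤s (m≤m+n β l))) ∷
  All.map (λ {x} → λ { (p , q) → <⇒≤ p , subst (x <_) (sym (+-suc β l)) q }) (up-range (suc β) l)

Linked-up : ∀ v β l → v < β → Linked _<_ (v ∷ up β l)
Linked-up v β zero _ = [-]
Linked-up v β (suc l) v<β = v<β ∷ Linked-up β (suc β) l ≤-refl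

up-≥ : ∀ β l → All (β ≤_) (up β l)
up-≥ β l = All.map proj₁ (up-range β l)

fromColumns-++ : ∀ G X → fromColumns (G ++ X) ≡ foldr attachColumn (fromColumns X) G
fromColumns-++ G X = List.foldr-++ attachColumn [] G X

insertTab-onto-stacked : ∀ {lo} β v G C rest → Stacked lo G β → β ≤ v → All (β ≤_) C → All (All (β ≤_)) rest →
  Linked _<_ (v ∷ C) → length (fromColumns rest) ≤ length C →
  insertTab v (fromColumns (G ++ C ∷ rest)) ≡ fromColumns (G ++ (v ∷ C) ∷ rest)
insertTab-onto-stacked β v G C rest sG β≤v aC arest lk len =
  begin
    insertTab v (fromColumns (G ++ C ∷ rest))
      ≡⟨ cong (insertTab v) (fromColumns-++ G (C ∷ rest)) ⟩
    insertTab v (foldr attachColumn (attachColumn C (fromColumns rest)) G)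
      ≡⟨ insertTab-past-columns β v G _ sG β≤v (All-attachColumn C (fromColumns rest) aC (All-foldr-attachColumn rest [] arest [])) ⟩
    foldr attachColumn (insertTab v (attachColumn C (fromColumns rest))) G
      ≡⟨ cong (λ z → foldr attachColumn z G) (insertTab-onto-column v C (fromColumns rest) lk len) ⟩
    foldr attachColumn (attachColumn (v ∷ C) (fromColumns rest)) G
      ≡⟨ sym (fromColumns-++ G ((v ∷ C) ∷ rest)) ⟩
    fromColumns (G ++ (v ∷ C) ∷ rest) ∎
  where open ≡-Reasoning

insertTab-after-stacked : ∀ {lo} β v G → Stacked lo G β → β ≤ v → insertTab v (fromColumns G) ≡ fromColumns (G ++ (v ∷ []) ∷ [])
insertTab-after-stacked β v G sG β≤v =
  begin
    insertTab v (fromColumns G)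
      ≡⟨ cong (insertTab v) (sym (fromColumns-++ G [])) ⟩
    insertTab v (foldr attachColumn [] (G ++ []))
      ≡⟨ cong (λ z → insertTab v (foldr attachColumn [] z)) (List.++-identityʳ G) ⟩
    insertTab v (foldr attachColumn [] G)
      ≡⟨ insertTab-past-columns β v G [] sG β≤v [] ⟩
    foldr attachColumn ((v ∷ []) ∷ []) G
      ≡⟨ sym (fromColumns-++ G ((v ∷ []) ∷ [])) ⟩
    fromColumns (G ++ (v ∷ []) ∷ []) ∎
  where open ≡-Reasoning

insertWord-down : ∀ {lo} β l k G rest → Stacked lo G β → All (All (β ≤_)) rest → length (fromColumns rest) ≤ k →
  insertWord (fromColumns (G ++ up (β + l) k ∷ rest)) (down β l) ≡ fromColumns (G ++ up β (l + k) ∷ rest)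
insertWord-down β zero k G rest sG ar len rewrite +-identityʳ β = refl
insertWord-down β (suc l) k G rest sG ar len
  rewrite +-suc β l
        | insertTab-onto-stacked β (β + l) G (up (suc (β + l)) k) rest sG (m≤m+n β l)
            (All.map (λ p → ≤-trans (m≤m+n β l) (≤-trans (n≤1+n _) p)) (up-≥ (suc (β + l)) k)) ar
            (Linked-up (β + l) (suc (β + l)) k ≤-refl) (subst (length (fromColumns rest) ≤_) (sym (length-up _ k)) len)
  = trans (insertWord-down β l (suc k) G rest sG ar (m≤n⇒m≤1+n len)) (cong (λ z → fromColumns (G ++ up β z ∷ rest)) (+-suc l k))

singles : ℕ → ℕ → Tableau
singles o zero = []
singles o (suc k) = (o ∷ []) ∷ singles (suc o) k

insertWord-up : ∀ {lo} β r G → Stacked lo G β → insertWord (fromColumns G) (up β r) ≡ fromColumns (G ++ singles β r)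
insertWord-up β zero G sG = cong fromColumns (sym (List.++-identityʳ G))
insertWord-up β (suc r) G sG
  rewrite insertTab-after-stacked β β G sG ≤-refl
  = trans (insertWord-up (suc β) r (G ++ (β ∷ []) ∷ []) (Stacked-∷ʳ sG (n≤1+n β) ((≤-refl , ≤-refl) ∷ [])))
          (cong fromColumns (List.++-assoc G ((β ∷ []) ∷ []) (singles (suc β) r)))

insertWord-blockBody : ∀ {lo} o a b en F′ → Stacked lo F′ o → o + suc (suc (a + b)) ≤ en →
  insertWord (fromColumns (F′ ++ (o + suc (a + b) ∷ []) ∷ [])) (blockBody o a b en)
  ≡ fromColumns (F′ ++ up (suc o) (suc (a + b)) ∷ (en ∷ []) ∷ [])
insertWord-blockBody o a b en F′ sF le =
  begin
    insertWord (fromColumns (F′ ++ (o + suc (a + b) ∷ []) ∷ [])) (blockBody o a b en)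
      ≡⟨ List.foldl-++ insertStep _ (down (o + suc b) a) (en ∷ down (suc o) b) ⟩
    insertWord (insertWord (fromColumns (F′ ++ (o + suc (a + b) ∷ []) ∷ [])) (down (o + suc b) a)) (en ∷ down (suc o) b)
      ≡⟨ cong (λ z → insertWord (insertWord (fromColumns (F′ ++ (z ∷ []) ∷ [])) (down (o + suc b) a)) (en ∷ down (suc o) b)) (top≡ o a b) ⟩
    insertWord (insertWord (fromColumns (F′ ++ up ((o + suc b) + a) 1 ∷ [])) (down (o + suc b) a)) (en ∷ down (suc o) b)
      ≡⟨ cong (λ z → insertWord z (en ∷ down (suc o) b)) (insertWord-down (o + suc b) a 1 F′ [] (Stacked-weaken sF (m≤m+n o (suc b))) [] z≤n) ⟩
    insertWord (insertTab en (fromColumns (F′ ++ up (o + suc b) (a + 1) ∷ []))) (down (suc o) b)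
      ≡⟨ cong (λ z → insertWord z (down (suc o) b)) (insertTab-after-stacked en en (F′ ++ up (o + suc b) (a + 1) ∷ []) sG ≤-refl) ⟩
    insertWord (fromColumns ((F′ ++ up (o + suc b) (a + 1) ∷ []) ++ (en ∷ []) ∷ [])) (down (suc o) b)
      ≡⟨ cong (λ z → insertWord (fromColumns z) (down (suc o) b)) (List.++-assoc F′ (up (o + suc b) (a + 1) ∷ []) ((en ∷ []) ∷ [])) ⟩
    insertWord (fromColumns (F′ ++ up (o + suc b) (a + 1) ∷ (en ∷ []) ∷ [])) (down (suc o) b)
      ≡⟨ cong (λ z → insertWord (fromColumns (F′ ++ up z (a + 1) ∷ (en ∷ []) ∷ [])) (down (suc o) b)) (o+1+b≡ o b) ⟩
    insertWord (fromColumns (F′ ++ up (suc o + b) (a + 1) ∷ (en ∷ []) ∷ [])) (down (suc o) b)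
      ≡⟨ insertWord-down (suc o) b (a + 1) F′ ((en ∷ []) ∷ []) (Stacked-weaken sF (n≤1+n o)) ((en≥ ∷ []) ∷ [])
           (subst (1 ≤_) (+-comm 1 a) (s≤s z≤n)) ⟩
    fromColumns (F′ ++ up (suc o) (b + (a + 1)) ∷ (en ∷ []) ∷ [])
      ≡⟨ cong (λ z → fromColumns (F′ ++ up (suc o) z ∷ (en ∷ []) ∷ [])) (height≡ a b) ⟩
    fromColumns (F′ ++ up (suc o) (suc (a + b)) ∷ (en ∷ []) ∷ []) ∎
  where
    open ≡-Reasoning
    top≡ : ∀ o a b → o + suc (a + b) ≡ (o + suc b) + a
    top≡ = solve-∀
    height≡ : ∀ a b → b + (a + 1) ≡ suc (a + b)
    height≡ = solve-∀
    bound≡ : ∀ o a b → (o + suc b) + (a + 1) ≡ o + suc (suc (a + b))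
    bound≡ = solve-∀
    o+1+b≡ : ∀ o b → o + suc b ≡ suc o + b
    o+1+b≡ = solve-∀
    en≥ : suc o ≤ en
    en≥ = ≤-trans (s≤s (m≤m+n o (suc (a + b)))) (≤-trans (≤-reflexive (sym (+-suc o (suc (a + b))))) le)
    sG : Stacked _ (F′ ++ up (o + suc b) (a + 1) ∷ []) en
    sG = Stacked-∷ʳ sF (≤-trans (m≤m+n o _) le)
           (All.map (λ { (p , q) → ≤-trans (m≤m+n o (suc b)) p , ≤-trans q (≤-trans (≤-reflexive (bound≡ o a b)) le) })
             (up-range (o + suc b) (a + 1)))

tailColumns : ℕ → Tail → Tableau
tailColumns o (column u v) = up o (suc (u + v)) ∷ []
tailColumns o (singletons r) = singles o (suc r)
tailColumns o (singletonsFixed r) = singles o (suc (suc r))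
tailColumns o twoOne = up o 2 ∷ (suc (suc o) ∷ []) ∷ []

columns : ℕ → List Block → Tail → Tableau
columns o [] tl = tailColumns o tl
columns o (bk ∷ bs) tl = up o (height bk) ∷ columns (o + height bk) bs tl

-- FitsAfter h bs tl: the word of a final column of height u + v + 1 first builds its top u + 1 entries, which
-- must not outgrow the previous column (of height h) while that still lacks its bottom entry.
FitsAfter : ℕ → List Block → Tail → Set
FitsAfter h [] (column u v) = suc u < h
FitsAfter h [] _ = ⊤
FitsAfter h (bk ∷ bs) tl = FitsAfter (height bk) bs tl

Fits : List Block → Tail → Set
Fits [] twoOne = ⊤
Fits [] _ = ⊥
Fits (bk ∷ bs) tl = FitsAfter (height bk) bs tl

topOf-≥ : ∀ o bs tl → o ≤ topOf o bs tl
topOf-≥ o [] (column u v) = m≤m+n o _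
topOf-≥ o [] (singletons r) = ≤-refl
topOf-≥ o [] (singletonsFixed r) = ≤-refl
topOf-≥ o [] twoOne = n≤1+n o
topOf-≥ o ((a , b) ∷ bs) tl = m≤m+n o _

length-attachColumn-[] : ∀ C → length (attachColumn C []) ≡ length C
length-attachColumn-[] [] = refl
length-attachColumn-[] (c ∷ C) = cong suc (length-attachColumn-[] C)

length-fromColumns-singles : ∀ o k → length (fromColumns (singles o k)) ≤ 1
length-fromColumns-singles o zero = z≤n
length-fromColumns-singles o (suc k) with fromColumns (singles (suc o) k) | length-fromColumns-singles (suc o) k
... | [] | _ = s≤s z≤n
... | r ∷ [] | _ = s≤s z≤n
... | r ∷ r′ ∷ rs | s≤s ()

singles-≥ : ∀ β o k → β ≤ o → All (All (β ≤_)) (singles o k)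
singles-≥ β o zero _ = []
singles-≥ β o (suc k) p = (p ∷ []) ∷ singles-≥ β (suc o) k (≤-trans p (n≤1+n o))

Stacked-singles : ∀ {lo} G o k → Stacked lo G o → Stacked lo (G ++ singles o k) (o + k)
Stacked-singles G o zero sG rewrite +-identityʳ o | List.++-identityʳ G = sG
Stacked-singles G o (suc k) sG rewrite +-suc o k =
  subst (λ z → Stacked _ z (suc (o + k))) (List.++-assoc G ((o ∷ []) ∷ []) (singles (suc o) k))
    (Stacked-singles (G ++ (o ∷ []) ∷ []) (suc o) k (Stacked-∷ʳ sG (n≤1+n o) ((≤-refl , ≤-refl) ∷ [])))

singles-∷ʳ : ∀ o k → singles o k ++ ((o + k) ∷ []) ∷ [] ≡ singles o (suc k)
singles-∷ʳ o zero rewrite +-identityʳ o = refl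
singles-∷ʳ o (suc k) rewrite +-suc o k = cong ((o ∷ []) ∷_) (singles-∷ʳ (suc o) k)

up-suc-≥ : ∀ x h → All (x ≤_) (up (suc x) h)
up-suc-≥ x h = All.map (≤-trans (n≤1+n x)) (up-≥ (suc x) h)

Stacked-∷ʳ-up : ∀ {lo} F x h → Stacked lo F x → Stacked lo (F ++ up x (suc h) ∷ []) (x + suc h)
Stacked-∷ʳ-up F x h sF = Stacked-∷ʳ sF (m≤m+n x _) (up-range x (suc h))

Stacked-∷ʳ-up-suc : ∀ {lo} F x h hi → Stacked lo F x → x + suc h ≤ hi → Stacked lo (F ++ up (suc x) h ∷ []) hi
Stacked-∷ʳ-up-suc F x h hi sF le = Stacked-∷ʳ sF (≤-trans (m≤m+n x _) le)
  (All.map (λ { (p , q) → ≤-trans (n≤1+n x) p , ≤-trans q (≤-trans (≤-reflexive (sym (+-suc x h))) le) }) (up-range (suc x) h))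

1≤length-up : ∀ β h → 1 ≤ h → 1 ≤ length (up β h)
1≤length-up β h 1≤h = subst (1 ≤_) (sym (length-up β h)) 1≤h

-- Once the columns F, the previous column [x, x + 1 + h) without its bottom entry x, and the top entry of the
-- next column are in place, the rest of the word completes all columns.
RestInsertion : Tableau → ℕ → ℕ → List Block → Tail → Set
RestInsertion F x h bs tl =
  insertWord (fromColumns (F ++ up (suc x) h ∷ (topOf (x + suc h) bs tl ∷ []) ∷ [])) (restWord x (suc h) bs tl)
  ≡ fromColumns (F ++ up x (suc h) ∷ columns (x + suc h) bs tl)

insertWord-column : ∀ {lo} F x h u v → Stacked lo F x → FitsAfter (suc h) [] (column u v) →
  RestInsertion F x h [] (column u v)
insertWord-column F x h u v sF fits =
  begin
    insertWord (fromColumns (F ++ up (suc x) h ∷ (o + (u + v) ∷ []) ∷ [])) (down (o + v) u ++ x ∷ down o v)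
      ≡⟨ List.foldl-++ insertStep _ (down (o + v) u) (x ∷ down o v) ⟩
    insertWord (insertWord (fromColumns (F ++ up (suc x) h ∷ (o + (u + v) ∷ []) ∷ [])) (down (o + v) u)) (x ∷ down o v)
      ≡⟨ cong (λ z → insertWord (insertWord (fromColumns z) (down (o + v) u)) (x ∷ down o v))
           (trans (sym (List.++-assoc F (up (suc x) h ∷ []) ((o + (u + v) ∷ []) ∷ [])))
                  (cong (λ w → (F ++ up (suc x) h ∷ []) ++ (w ∷ []) ∷ []) (top≡ o u v))) ⟩
    insertWord (insertWord (fromColumns (G ++ up ((o + v) + u) 1 ∷ [])) (down (o + v) u)) (x ∷ down o v)
      ≡⟨ cong (λ z → insertWord z (x ∷ down o v)) (insertWord-down (o + v) u 1 G [] sG [] z≤n) ⟩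
    insertWord (insertTab x (fromColumns (G ++ up (o + v) (u + 1) ∷ []))) (down o v)
      ≡⟨ cong (λ z → insertWord (insertTab x (fromColumns z)) (down o v)) (List.++-assoc F (up (suc x) h ∷ []) (up (o + v) (u + 1) ∷ [])) ⟩
    insertWord (insertTab x (fromColumns (F ++ up (suc x) h ∷ up (o + v) (u + 1) ∷ []))) (down o v)
      ≡⟨ cong (λ z → insertWord z (down o v))
           (insertTab-onto-stacked x x F (up (suc x) h) (up (o + v) (u + 1) ∷ []) sF ≤-refl (up-suc-≥ x h)
             (All.map (≤-trans (≤-trans (m≤m+n x (suc h)) (m≤m+n o v))) (up-≥ (o + v) (u + 1)) ∷ [])
             (Linked-up x (suc x) h ≤-refl) shorter) ⟩
    insertWord (fromColumns (F ++ up x (suc h) ∷ up (o + v) (u + 1) ∷ [])) (down o v)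
      ≡⟨ cong (λ z → insertWord (fromColumns z) (down o v)) (sym (List.++-assoc F (up x (suc h) ∷ []) (up (o + v) (u + 1) ∷ []))) ⟩
    insertWord (fromColumns (F′ ++ up (o + v) (u + 1) ∷ [])) (down o v)
      ≡⟨ insertWord-down o v (u + 1) F′ [] (Stacked-∷ʳ-up F x h sF) [] z≤n ⟩
    fromColumns (F′ ++ up o (v + (u + 1)) ∷ [])
      ≡⟨ cong (λ z → fromColumns (F′ ++ up o z ∷ [])) (height≡ u v) ⟩
    fromColumns (F′ ++ up o (suc (u + v)) ∷ [])
      ≡⟨ cong fromColumns (List.++-assoc F (up x (suc h) ∷ []) (up o (suc (u + v)) ∷ [])) ⟩
    fromColumns (F ++ up x (suc h) ∷ up o (suc (u + v)) ∷ []) ∎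
  where
    open ≡-Reasoning
    o = x + suc h
    G = F ++ up (suc x) h ∷ []
    F′ = F ++ up x (suc h) ∷ []
    sG : Stacked _ G (o + v)
    sG = Stacked-∷ʳ-up-suc F x h (o + v) sF (m≤m+n o v)
    shorter : length (fromColumns (up (o + v) (u + 1) ∷ [])) ≤ length (up (suc x) h)
    shorter rewrite length-attachColumn-[] (up (o + v) (u + 1)) | length-up (o + v) (u + 1) | length-up (suc x) h
      = subst (_≤ h) (+-comm 1 u) (≤-pred fits)
    top≡ : ∀ o u v → o + (u + v) ≡ (o + v) + u
    top≡ = solve-∀
    height≡ : ∀ u v → v + (u + 1) ≡ suc (u + v)
    height≡ = solve-∀

insertWord-singletons : ∀ {lo} F x h r → Stacked lo F x → 1 ≤ h → RestInsertion F x h [] (singletons r)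
insertWord-singletons F x h r sF 1≤ =
  begin
    insertWord (fromColumns (F ++ up (suc x) h ∷ (o ∷ []) ∷ [])) (up (suc o) r ++ x ∷ [])
      ≡⟨ List.foldl-++ insertStep _ (up (suc o) r) (x ∷ []) ⟩
    insertTab x (insertWord (fromColumns (F ++ up (suc x) h ∷ (o ∷ []) ∷ [])) (up (suc o) r))
      ≡⟨ cong (insertTab x) (insertWord-up (suc o) r (F ++ up (suc x) h ∷ (o ∷ []) ∷ []) sG) ⟩
    insertTab x (fromColumns ((F ++ up (suc x) h ∷ (o ∷ []) ∷ []) ++ singles (suc o) r))
      ≡⟨ cong (λ z → insertTab x (fromColumns z)) (List.++-assoc F (up (suc x) h ∷ (o ∷ []) ∷ []) (singles (suc o) r)) ⟩
    insertTab x (fromColumns (F ++ up (suc x) h ∷ singles o (suc r)))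
      ≡⟨ insertTab-onto-stacked x x F (up (suc x) h) (singles o (suc r)) sF ≤-refl (up-suc-≥ x h)
           (singles-≥ x o (suc r) (m≤m+n x (suc h))) (Linked-up x (suc x) h ≤-refl)
           (≤-trans (length-fromColumns-singles o (suc r)) (subst (1 ≤_) (sym (length-up (suc x) h)) 1≤)) ⟩
    fromColumns (F ++ up x (suc h) ∷ singles o (suc r)) ∎
  where
    open ≡-Reasoning
    o = x + suc h
    sG : Stacked _ (F ++ up (suc x) h ∷ (o ∷ []) ∷ []) (suc o)
    sG = subst (λ z → Stacked _ z (suc o)) (List.++-assoc F (up (suc x) h ∷ []) ((o ∷ []) ∷ []))
           (Stacked-∷ʳ (Stacked-∷ʳ-up-suc F x h o sF ≤-refl) (n≤1+n o) ((≤-refl , ≤-refl) ∷ []))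

insertWord-singletonsFixed : ∀ {lo} F x h r → Stacked lo F x → 1 ≤ h → RestInsertion F x h [] (singletonsFixed r)
insertWord-singletonsFixed F x h r sF 1≤ =
  begin
    insertWord T₀ (up (suc o) r ++ x ∷ suc (o + r) ∷ [])
      ≡⟨ cong (insertWord T₀) (List.++-assoc (up (suc o) r) (x ∷ []) (suc (o + r) ∷ [])) ⟨
    insertWord T₀ ((up (suc o) r ++ x ∷ []) ++ suc (o + r) ∷ [])
      ≡⟨ List.foldl-++ insertStep T₀ (up (suc o) r ++ x ∷ []) (suc (o + r) ∷ []) ⟩
    insertTab (suc (o + r)) (insertWord T₀ (up (suc o) r ++ x ∷ []))
      ≡⟨ cong (insertTab (suc (o + r))) (insertWord-singletons F x h r sF 1≤) ⟩
    insertTab (suc (o + r)) (fromColumns (F ++ up x (suc h) ∷ singles o (suc r)))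
      ≡⟨ cong (λ z → insertTab (suc (o + r)) (fromColumns z)) (sym (List.++-assoc F (up x (suc h) ∷ []) (singles o (suc r)))) ⟩
    insertTab (suc (o + r)) (fromColumns (F′ ++ singles o (suc r)))
      ≡⟨ insertTab-after-stacked (o + suc r) (suc (o + r)) (F′ ++ singles o (suc r))
           (Stacked-singles F′ o (suc r) (Stacked-∷ʳ-up F x h sF)) (≤-reflexive (+-suc o r)) ⟩
    fromColumns ((F′ ++ singles o (suc r)) ++ (suc (o + r) ∷ []) ∷ [])
      ≡⟨ cong fromColumns (List.++-assoc F′ (singles o (suc r)) ((suc (o + r) ∷ []) ∷ [])) ⟩
    fromColumns (F′ ++ singles o (suc r) ++ (suc (o + r) ∷ []) ∷ [])
      ≡⟨ cong (λ z → fromColumns (F′ ++ singles o (suc r) ++ (z ∷ []) ∷ [])) (sym (+-suc o r)) ⟩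
    fromColumns (F′ ++ singles o (suc r) ++ (o + suc r ∷ []) ∷ [])
      ≡⟨ cong (λ z → fromColumns (F′ ++ z)) (singles-∷ʳ o (suc r)) ⟩
    fromColumns (F′ ++ singles o (suc (suc r)))
      ≡⟨ cong fromColumns (List.++-assoc F (up x (suc h) ∷ []) (singles o (suc (suc r)))) ⟩
    fromColumns (F ++ up x (suc h) ∷ singles o (suc (suc r))) ∎
  where
    open ≡-Reasoning
    o = x + suc h
    T₀ = fromColumns (F ++ up (suc x) h ∷ (o ∷ []) ∷ [])
    F′ = F ++ up x (suc h) ∷ []

insertWord-twoOne : ∀ {lo} F x h → Stacked lo F x → 1 ≤ h → RestInsertion F x h [] twoOne
insertWord-twoOne F x h sF 1≤ =
  begin
    insertTab (suc (suc o)) (insertTab o (insertTab x (fromColumns (F ++ up (suc x) h ∷ (suc o ∷ []) ∷ []))))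
      ≡⟨ cong (λ z → insertTab (suc (suc o)) (insertTab o z))
           (insertTab-onto-stacked x x F (up (suc x) h) ((suc o ∷ []) ∷ []) sF ≤-refl (up-suc-≥ x h)
              ((≤-trans (m≤m+n x (suc h)) (n≤1+n o) ∷ []) ∷ []) (Linked-up x (suc x) h ≤-refl) (1≤length-up (suc x) h 1≤)) ⟩
    insertTab (suc (suc o)) (insertTab o (fromColumns (F ++ up x (suc h) ∷ (suc o ∷ []) ∷ [])))
      ≡⟨ cong (λ z → insertTab (suc (suc o)) (insertTab o (fromColumns z))) (sym (List.++-assoc F (up x (suc h) ∷ []) ((suc o ∷ []) ∷ []))) ⟩
    insertTab (suc (suc o)) (insertTab o (fromColumns (F′ ++ (suc o ∷ []) ∷ [])))
      ≡⟨ cong (insertTab (suc (suc o))) (insertTab-onto-stacked o o F′ (suc o ∷ []) [] (Stacked-∷ʳ-up F x h sF) ≤-refl (n≤1+n o ∷ []) []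
            (≤-refl ∷ [-]) z≤n) ⟩
    insertTab (suc (suc o)) (fromColumns (F′ ++ up o 2 ∷ []))
      ≡⟨ insertTab-after-stacked (suc (suc o)) (suc (suc o)) (F′ ++ up o 2 ∷ [])
           (Stacked-∷ʳ (Stacked-∷ʳ-up F x h sF) (≤-trans (n≤1+n o) (n≤1+n (suc o))) up-range′) ≤-refl ⟩
    fromColumns ((F′ ++ up o 2 ∷ []) ++ (suc (suc o) ∷ []) ∷ [])
      ≡⟨ cong fromColumns (trans (List.++-assoc F′ (up o 2 ∷ []) ((suc (suc o) ∷ []) ∷ [])) (List.++-assoc F (up x (suc h) ∷ []) _)) ⟩
    fromColumns (F ++ up x (suc h) ∷ up o 2 ∷ (suc (suc o) ∷ []) ∷ []) ∎
  where
    open ≡-Reasoning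
    o = x + suc h
    F′ = F ++ up x (suc h) ∷ []
    up-range′ : All (λ y → o ≤ y × y < suc (suc o)) (up o 2)
    up-range′ = (≤-refl , n≤1+n (suc o)) ∷ (n≤1+n o , ≤-refl) ∷ []

insertWord-restWord : ∀ {lo} F x h bs tl → Stacked lo F x → 1 ≤ h → FitsAfter (suc h) bs tl → RestInsertion F x h bs tl
insertWord-restWord F x h ((a , b) ∷ bs) tl sF 1≤ fits =
  begin
    insertWord (insertTab x (fromColumns (F ++ up (suc x) h ∷ (e ∷ []) ∷ []))) (blockBody o a b en ++ restWord o c bs tl)
      ≡⟨ cong (λ z → insertWord z (blockBody o a b en ++ restWord o c bs tl))
           (insertTab-onto-stacked x x F (up (suc x) h) ((e ∷ []) ∷ []) sF ≤-refl (up-suc-≥ x h)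
              ((e≥ ∷ []) ∷ []) (Linked-up x (suc x) h ≤-refl) (1≤length-up (suc x) h 1≤)) ⟩
    insertWord (fromColumns (F ++ up x (suc h) ∷ (e ∷ []) ∷ [])) (blockBody o a b en ++ restWord o c bs tl)
      ≡⟨ cong (λ z → insertWord (fromColumns z) (blockBody o a b en ++ restWord o c bs tl)) (sym (List.++-assoc F (up x (suc h) ∷ []) ((e ∷ []) ∷ []))) ⟩
    insertWord (fromColumns (F′ ++ (e ∷ []) ∷ [])) (blockBody o a b en ++ restWord o c bs tl)
      ≡⟨ List.foldl-++ insertStep _ (blockBody o a b en) (restWord o c bs tl) ⟩
    insertWord (insertWord (fromColumns (F′ ++ (e ∷ []) ∷ [])) (blockBody o a b en)) (restWord o c bs tl)
      ≡⟨ cong (λ z → insertWord z (restWord o c bs tl)) (insertWord-blockBody o a b en F′ sF′ (topOf-≥ (o + c) bs tl)) ⟩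
    insertWord (fromColumns (F′ ++ up (suc o) (suc (a + b)) ∷ (en ∷ []) ∷ [])) (restWord o c bs tl)
      ≡⟨ insertWord-restWord F′ o (suc (a + b)) bs tl sF′ (s≤s z≤n) fits ⟩
    fromColumns (F′ ++ up o c ∷ columns (o + c) bs tl)
      ≡⟨ cong fromColumns (List.++-assoc F (up x (suc h) ∷ []) (up o c ∷ columns (o + c) bs tl)) ⟩
    fromColumns (F ++ up x (suc h) ∷ columns o ((a , b) ∷ bs) tl) ∎
  where
    open ≡-Reasoning
    o = x + suc h
    c = height (a , b)
    e = o + suc (a + b)
    en = topOf (o + c) bs tl
    F′ = F ++ up x (suc h) ∷ []
    sF′ = Stacked-∷ʳ-up F x h sF
    e≥ : x ≤ e
    e≥ = ≤-trans (m≤m+n x (suc h)) (m≤m+n o _)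
insertWord-restWord F x h [] (column u v)        sF _  fits = insertWord-column F x h u v sF fits
insertWord-restWord F x h [] (singletons r)      sF 1≤ _    = insertWord-singletons F x h r sF 1≤
insertWord-restWord F x h [] (singletonsFixed r) sF 1≤ _    = insertWord-singletonsFixed F x h r sF 1≤
insertWord-restWord F x h [] twoOne              sF 1≤ _    = insertWord-twoOne F x h sF 1≤

P-word : ∀ o bs tl → Fits bs tl → P (word o bs tl) ≡ fromColumns (columns o bs tl)
P-word o ((a , b) ∷ bs) tl fits =
  begin
    insertWord ((e ∷ []) ∷ []) (blockBody o a b en ++ restWord o c bs tl)
      ≡⟨ List.foldl-++ insertStep _ (blockBody o a b en) (restWord o c bs tl) ⟩
    insertWord (insertWord (fromColumns ([] ++ (e ∷ []) ∷ [])) (blockBody o a b en)) (restWord o c bs tl)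
      ≡⟨ cong (λ z → insertWord z (restWord o c bs tl)) (insertWord-blockBody o a b en [] ([] ≤-refl) (topOf-≥ (o + c) bs tl)) ⟩
    insertWord (fromColumns (up (suc o) (suc (a + b)) ∷ (en ∷ []) ∷ [])) (restWord o c bs tl)
      ≡⟨ insertWord-restWord [] o (suc (a + b)) bs tl ([] ≤-refl) (s≤s z≤n) fits ⟩
    fromColumns (up o c ∷ columns (o + c) bs tl) ∎
  where
    open ≡-Reasoning
    c = height (a , b)
    e = o + suc (a + b)
    en = topOf (o + c) bs tl
P-word o [] twoOne fits =
  begin
    insertTab (suc (suc o)) (insertTab o (fromColumns ([] ++ (suc o ∷ []) ∷ [])))
      ≡⟨ cong (insertTab (suc (suc o))) (insertTab-onto-stacked o o [] (suc o ∷ []) [] ([] ≤-refl) ≤-refl (n≤1+n o ∷ []) [] (≤-refl ∷ [-]) z≤n) ⟩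
    insertTab (suc (suc o)) (fromColumns (up o 2 ∷ []))
      ≡⟨ insertTab-after-stacked (suc (suc o)) (suc (suc o)) (up o 2 ∷ [])
           (Stacked-∷ʳ ([] ≤-refl) (≤-trans (n≤1+n o) (n≤1+n (suc o))) ((≤-refl , n≤1+n (suc o)) ∷ (n≤1+n o , ≤-refl) ∷ [])) ≤-refl ⟩
    fromColumns (up o 2 ∷ (suc (suc o) ∷ []) ∷ []) ∎
  where open ≡-Reasoning

heights : List Block → Tail → List ℕ
heights [] (column u v) = suc (u + v) ∷ []
heights [] (singletons r) = replicate (suc r) 1
heights [] (singletonsFixed r) = replicate (suc (suc r)) 1
heights [] twoOne = 2 ∷ 1 ∷ []
heights (bk ∷ bs) tl = height bk ∷ heights bs tl

map-length-singles : ∀ o k → map length (singles o k) ≡ replicate k 1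
map-length-singles o zero = refl
map-length-singles o (suc k) = cong (1 ∷_) (map-length-singles (suc o) k)

map-length-columns : ∀ o bs tl → map length (columns o bs tl) ≡ heights bs tl
map-length-columns o [] (column u v) = cong (_∷ []) (length-up o _)
map-length-columns o [] (singletons r) = map-length-singles o (suc r)
map-length-columns o [] (singletonsFixed r) = map-length-singles o (suc (suc r))
map-length-columns o [] twoOne = refl
map-length-columns o (bk ∷ bs) tl = cong₂ _∷_ (length-up o (height bk)) (map-length-columns (o + height bk) bs tl)

insertRow-↭ : ∀ v r → proj₁ (insertRow v r) ++ fromMaybe (proj₂ (insertRow v r)) ↭ v ∷ r
insertRow-↭ v [] = ↭-refl
insertRow-↭ v (b ∷ bs) with suc v ≤ᵇ b
... | true = prep v (++-comm bs (b ∷ []))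
... | false with insertRow v bs | insertRow-↭ v bs
...   | bs′ , m | ih = ↭-trans (prep b ih) (swap b v ↭-refl)

insertTab-↭ : ∀ v T → concat (insertTab v T) ↭ v ∷ concat T
insertTab-↭ v [] = ↭-refl
insertTab-↭ v (row ∷ rs) with insertRow v row | insertRow-↭ v row
... | row′ , nothing | ih =
  ↭-trans (↭-reflexive (cong (_++ concat rs) (sym (List.++-identityʳ row′)))) (++⁺ʳ (concat rs) ih)
... | row′ , just b | ih =
  ↭-trans (++⁺ˡ row′ (insertTab-↭ b rs))
    (↭-trans (↭-reflexive (sym (List.++-assoc row′ (b ∷ []) (concat rs)))) (++⁺ʳ (concat rs) ih))

insertWord-↭ : ∀ T w → concat (insertWord T w) ↭ w ++ concat T
insertWord-↭ T [] = ↭-refl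
insertWord-↭ T (a ∷ w) = ↭-trans (insertWord-↭ (insertStep T a) w) (↭-trans (++⁺ˡ w (insertTab-↭ a T)) (shift a w (concat T)))

attachColumn-↭ : ∀ C rs → concat (attachColumn C rs) ↭ C ++ concat rs
attachColumn-↭ [] rs = ↭-refl
attachColumn-↭ (c ∷ cs) [] = prep c (attachColumn-↭ cs [])
attachColumn-↭ (c ∷ cs) (r ∷ rs) = prep c (↭-trans (++⁺ˡ r (attachColumn-↭ cs rs)) (shifts r cs))

fromColumns-↭ : ∀ cols → concat (fromColumns cols) ↭ concat cols
fromColumns-↭ [] = ↭-refl
fromColumns-↭ (C ∷ cols) = ↭-trans (attachColumn-↭ C (fromColumns cols)) (++⁺ˡ C (fromColumns-↭ cols))

up-++ : ∀ o a b → up o a ++ up (o + a) b ≡ up o (a + b)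
up-++ o zero b rewrite +-identityʳ o = refl
up-++ o (suc a) b rewrite +-suc o a = cong (o ∷_) (up-++ (suc o) a b)

concat-singles : ∀ o k → concat (singles o k) ≡ up o k
concat-singles o zero = refl
concat-singles o (suc k) = cong (o ∷_) (concat-singles (suc o) k)

sum-replicate-1 : ∀ s → sum (replicate s 1) ≡ s
sum-replicate-1 zero    = refl
sum-replicate-1 (suc s) = cong suc (sum-replicate-1 s)

concat-columns : ∀ o bs tl → concat (columns o bs tl) ≡ up o (sum (heights bs tl))
concat-columns o [] (column u v) = trans (List.++-identityʳ _) (cong (up o) (sym (+-identityʳ _)))
concat-columns o [] (singletons r) = trans (concat-singles o (suc r)) (cong (up o) (sym (sum-replicate-1 (suc r))))
concat-columns o [] (singletonsFixed r) = trans (concat-singles o (suc (suc r))) (cong (up o) (sym (sum-replicate-1 (suc (suc r)))))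
concat-columns o [] twoOne = cong (λ z → o ∷ suc o ∷ suc (suc o) ∷ z) refl
concat-columns o (bk ∷ bs) tl = trans (cong (up o (height bk) ++_) (concat-columns (o + height bk) bs tl)) (up-++ o (height bk) _)

up≡applyUpTo : ∀ β n (f : ℕ → ℕ) → (∀ i → f i ≡ β + i) → up β n ≡ applyUpTo f n
up≡applyUpTo β zero f h = refl
up≡applyUpTo β (suc n) f h = cong₂ _∷_ (trans (sym (+-identityʳ β)) (sym (h 0)))
  (up≡applyUpTo (suc β) n (λ i → f (suc i)) (λ i → trans (h (suc i)) (+-suc β i)))

word↭upTo : ∀ bs tl → Fits bs tl → word 0 bs tl ↭ upTo (sum (heights bs tl))
word↭upTo bs tl fits = begin
  word 0 bs tl                             ≡⟨ List.++-identityʳ (word 0 bs tl) ⟨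
  word 0 bs tl ++ []                       ↭⟨ insertWord-↭ [] (word 0 bs tl) ⟨
  concat (P (word 0 bs tl))                ≡⟨ cong concat (P-word 0 bs tl fits) ⟩
  concat (fromColumns (columns 0 bs tl))   ↭⟨ fromColumns-↭ (columns 0 bs tl) ⟩
  concat (columns 0 bs tl)                 ≡⟨ concat-columns 0 bs tl ⟩
  up 0 (sum (heights bs tl))               ≡⟨ up≡applyUpTo 0 _ (λ i → i) (λ i → refl) ⟩
  upTo (sum (heights bs tl))               ∎
  where open PermutationReasoning

map-suc-down : ∀ β l → map suc (down β l) ≡ down (suc β) l
map-suc-down β zero = refl
map-suc-down β (suc l) = cong (suc (β + l) ∷_) (map-suc-down β l)

map-suc-up : ∀ β l → map suc (up β l) ≡ up (suc β) l
map-suc-up β zero = refl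
map-suc-up β (suc l) = cong (suc β ∷_) (map-suc-up (suc β) l)

tailTop-suc : ∀ o tl → tailTop (suc o) tl ≡ suc (tailTop o tl)
tailTop-suc o (column u v) = refl
tailTop-suc o (singletons r) = refl
tailTop-suc o (singletonsFixed r) = refl
tailTop-suc o twoOne = refl

topOf-suc : ∀ o bs tl → topOf (suc o) bs tl ≡ suc (topOf o bs tl)
topOf-suc o [] tl = tailTop-suc o tl
topOf-suc o ((a , b) ∷ bs) tl = refl

map-suc-blockBody : ∀ o a b en → map suc (blockBody o a b en) ≡ blockBody (suc o) a b (suc en)
map-suc-blockBody o a b en = trans (List.map-++ suc (down (o + suc b) a) (en ∷ down (suc o) b))
  (cong₂ _++_ (map-suc-down (o + suc b) a) (cong (suc en ∷_) (map-suc-down (suc o) b)))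

map-suc-tailWord : ∀ o x tl → map suc (tailWord o x tl) ≡ tailWord (suc o) (suc x) tl
map-suc-tailWord o x (column u v) = trans (List.map-++ suc (down (o + v) u) (x ∷ down o v))
  (cong₂ _++_ (map-suc-down (o + v) u) (cong (suc x ∷_) (map-suc-down o v)))
map-suc-tailWord o x (singletons r) = trans (List.map-++ suc (up (suc o) r) (x ∷ [])) (cong (_++ suc x ∷ []) (map-suc-up (suc o) r))
map-suc-tailWord o x (singletonsFixed r) =
  trans (List.map-++ suc (up (suc o) r) (x ∷ suc (o + r) ∷ [])) (cong (_++ suc x ∷ suc (suc (o + r)) ∷ []) (map-suc-up (suc o) r))
map-suc-tailWord o x twoOne = refl

map-suc-restWord : ∀ x h bs tl → map suc (restWord x h bs tl) ≡ restWord (suc x) h bs tl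
map-suc-restWord x h [] tl = map-suc-tailWord (x + h) x tl
map-suc-restWord x h ((a , b) ∷ bs) tl =
  cong (suc x ∷_) (trans (List.map-++ suc (blockBody (x + h) a b _) (restWord (x + h) (height (a , b)) bs tl))
    (cong₂ _++_ (trans (map-suc-blockBody (x + h) a b _) (cong (blockBody (suc x + h) a b) (sym (topOf-suc _ bs tl))))
      (map-suc-restWord (x + h) (height (a , b)) bs tl)))

map-suc-word : ∀ o bs tl → map suc (word o bs tl) ≡ word (suc o) bs tl
map-suc-word o [] tl = trans (map-suc-tailWord o (tailTop o tl) tl) (cong (λ z → tailWord (suc o) z tl) (sym (tailTop-suc o tl)))
map-suc-word o ((a , b) ∷ bs) tl =
  cong (suc (o + suc (a + b)) ∷_) (trans (List.map-++ suc (blockBody o a b _) (restWord o (height (a , b)) bs tl))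
    (cong₂ _++_ (trans (map-suc-blockBody o a b _) (cong (blockBody (suc o) a b) (sym (topOf-suc _ bs tl))))
      (map-suc-restWord o (height (a , b)) bs tl)))

-- Its cycle structure

nth-++ʳ : ∀ xs ys i → nth (xs ++ ys) (length xs + i) ≡ nth ys i
nth-++ʳ [] ys i = refl
nth-++ʳ (x ∷ xs) ys i = nth-++ʳ xs ys i

nth-++ˡ : ∀ xs ys i → i < length xs → nth (xs ++ ys) i ≡ nth xs i
nth-++ˡ (x ∷ xs) ys zero _ = refl
nth-++ˡ (x ∷ xs) ys (suc i) (s≤s p) = nth-++ˡ xs ys i p

nth-down : ∀ β i j → nth (down β (suc (i + j))) i ≡ β + j
nth-down β zero j = refl
nth-down β (suc i) j = nth-down β i j

nth-up : ∀ β i j → nth (up β (suc (i + j))) i ≡ β + i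
nth-up β zero j = sym (+-identityʳ β)
nth-up β (suc i) j = trans (nth-up (suc β) i j) (sym (+-suc β i))

length-down : ∀ β l → length (down β l) ≡ l
length-down β zero = refl
length-down β (suc l) = cong suc (length-down β l)

module Zigzag (W : List ℕ) (o base top A B : ℕ)
  (upper↦lower : ∀ k → k < B → (o + (top ∸ k)) < length W × nth W (o + (top ∸ k)) ≡ o + (base + k))
  (lower↦upper : ∀ k → k < A → (o + (base + k)) < length W × nth W (o + (base + k)) ≡ o + (top ∸ suc k)) where

  zigzag : ∀ k → (k ≤ A → k ≤ B → Walk W (o + (top ∸ k)) (o + top)) × (k < B → k ≤ A → Walk W (o + (base + k)) (o + top))
  zigzag zero = (λ _ _ → done) , λ 0<B _ → bwd (proj₁ (upper↦lower 0 0<B)) (proj₂ (upper↦lower 0 0<B)) done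
  zigzag (suc k) = fromUpper , fromLower
    where
      fromUpper : suc k ≤ A → suc k ≤ B → Walk W (o + (top ∸ suc k)) (o + top)
      fromUpper k<A k<B = bwd (proj₁ (lower↦upper k k<A)) (proj₂ (lower↦upper k k<A)) (proj₂ (zigzag k) k<B (<⇒≤ k<A))
      fromLower : suc k < B → suc k ≤ A → Walk W (o + (base + suc k)) (o + top)
      fromLower k<B k<A = bwd (proj₁ (upper↦lower (suc k) k<B)) (proj₂ (upper↦lower (suc k) k<B)) (fromUpper k<A (<⇒≤ k<B))

  walk-upper : ∀ k → k ≤ A → k ≤ B → Walk W (o + (top ∸ k)) (o + top)
  walk-upper k = proj₁ (zigzag k)

  walk-lower : ∀ k → k < B → k ≤ A → Walk W (o + (base + k)) (o + top)
  walk-lower k = proj₂ (zigzag k)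

module Segment (W pre S : List ℕ) (o : ℕ) (W≡ : W ≡ pre ++ S) (length-pre : length pre ≡ o) where

  nth-offset : ∀ i → nth W (o + i) ≡ nth S i
  nth-offset i rewrite W≡ | sym length-pre = nth-++ʳ pre S i

  offset<length : ∀ i → i < length S → o + i < length W
  offset<length i i< rewrite W≡ | sym length-pre | List.length-++ pre {S} = +-monoʳ-< (length pre) i<

<⇒≡1+[+] : ∀ {k n} → k < n → ∃ λ i → n ≡ suc (i + k)
<⇒≡1+[+] {k} k<n with m≤n⇒∃[o]m+o≡n k<n
... | i , refl = i , cong suc (+-comm k i)

-- With top = a + b + 1, the segment of a block at position o holds x at offset 0, o + (top ∸ d) at offset
-- d ∈ [1, a], en at offset a + 1 and o + (1 + top ∸ d) at offset d ∈ [a + 2, top]: away from the slot a + 1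
-- the map d ↦ W(o + d) ∸ o is a reflection, so its edges zigzag between the two ends of [1, top].
module BlockSegment (W pre rest : List ℕ) (o x a b en : ℕ)
  (W≡ : W ≡ pre ++ x ∷ blockBody o a b en ++ rest) (length-pre : length pre ≡ o) where
  open Segment W pre (x ∷ blockBody o a b en ++ rest) o W≡ length-pre public

  private
    body : List ℕ
    body = down (o + suc b) a ++ en ∷ down (suc o) b ++ rest

    body≡ : blockBody o a b en ++ rest ≡ body
    body≡ = List.++-assoc (down (o + suc b) a) (en ∷ down (suc o) b) rest

    nth-body : ∀ i → nth W (o + suc i) ≡ nth body i
    nth-body i = trans (nth-offset (suc i)) (cong (λ w → nth w i) body≡)

    length-body : length body ≡ a + suc (b + length rest)
    length-body = trans (List.length-++ (down (o + suc b) a) {en ∷ down (suc o) b ++ rest})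
      (cong₂ _+_ (length-down _ a) (cong suc (trans (List.length-++ (down (suc o) b) {rest}) (cong (_+ length rest) (length-down _ b)))))

  inBlock : ∀ d → d ≤ suc (a + b) → o + d < length W
  inBlock d p = offset<length d (s≤s (≤-trans p (≤-trans (≤-reflexive (sym (+-suc a b)))
                  (≤-trans (+-monoʳ-≤ a (s≤s (m≤m+n b (length rest)))) (≤-reflexive (trans (sym length-body) (cong length (sym body≡))))))))

  nth-start : nth W (o + 0) ≡ x
  nth-start = nth-offset 0

  nth-slot : nth W (o + suc a) ≡ en
  nth-slot = trans (nth-body a) (subst (λ z → nth body z ≡ en) (+-identityʳ a)
               (trans (cong (λ z → nth body z) (cong (_+ 0) (sym (length-down (o + suc b) a))))
                 (nth-++ʳ (down (o + suc b) a) (en ∷ (down (suc o) b ++ rest)) 0)))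

  lower↦upper : ∀ k → k < a → (o + (1 + k)) < length W × nth W (o + (1 + k)) ≡ o + (suc (a + b) ∸ suc k)
  lower↦upper k k<a with m≤n⇒∃[o]m+o≡n k<a
  ... | j , refl = inBlock (suc k) (s≤s (≤-trans (<⇒≤ k<a) (m≤m+n _ b))) ,
      trans (nth-body k)
        (trans (nth-++ˡ (down (o + suc b) a) (en ∷ (down (suc o) b ++ rest)) k (subst (k <_) (sym (length-down _ a)) k<a))
          (trans (nth-down (o + suc b) k j)
            (trans (trans (+-assoc o (suc b) j) (cong (λ m → o + suc m) (+-comm b j)))
              (cong (o +_) (sym (trans (cong (_∸ k) (shuffle k j b)) (m+n∸n≡m (suc (j + b)) k)))))))
    where
      shuffle : ∀ k j b → suc (k + j) + b ≡ suc (j + b) + k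
      shuffle = solve-∀

  upper↦lower : ∀ k → k < b → (o + (suc (a + b) ∸ k)) < length W × nth W (o + (suc (a + b) ∸ k)) ≡ o + (1 + k)
  upper↦lower k k<b with <⇒≡1+[+] k<b
  ... | i , refl = subst (λ z → (o + z) < length W × nth W (o + z) ≡ o + (1 + k)) (sym posEq)
      (inBlock (suc (suc (a + i))) (s≤s (≤-trans (≤-reflexive (sym (+-suc a i))) (+-monoʳ-≤ a (s≤s (m≤m+n i k))))) ,
       trans (cong (nth W) (cong (o +_) (cong suc (sym (+-suc a i)))))
        (trans (nth-body (a + suc i))
          (trans (cong (λ z → nth body (z + suc i)) (sym (length-down (o + suc b) a)))
            (trans (nth-++ʳ (down (o + suc b) a) (en ∷ (down (suc o) b ++ rest)) (suc i))
              (trans (nth-++ˡ (down (suc o) b) rest i (subst (i <_) (sym (length-down _ b)) (s≤s (m≤m+n i k))))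
                (trans (nth-down (suc o) i k) (sym (+-suc o k))))))))
    where
      posEq : suc (a + suc (i + k)) ∸ k ≡ suc (suc (a + i))
      posEq = trans (cong (_∸ k) (shuffle a i k)) (m+n∸n≡m _ k)
        where
          shuffle : ∀ a i k → suc (a + suc (i + k)) ≡ suc (suc (a + i)) + k
          shuffle = solve-∀

-- The block shapes used: the reflection has no fixed offset when b ∈ {a, 1 + a}, and exactly one when
-- a ≡ 1 + b or b ≡ 2 + a.
data BlockKind (a b : ℕ) : Set where
  a≡b   : b ≡ a → BlockKind a b
  b≡1+a : b ≡ suc a → BlockKind a b
  a≡1+b : a ≡ suc b → BlockKind a b
  b≡2+a : b ≡ suc (suc a) → BlockKind a b

IsFixed : ∀ {a b} → BlockKind a b → ℕ → Set
IsFixed     (a≡b _)   d = ⊥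
IsFixed     (b≡1+a _) d = ⊥
IsFixed {a} (a≡1+b _) d = d ≡ a
IsFixed {a} (b≡2+a _) d = d ≡ suc (suc a)

∸-bound : ∀ t L d X → L ≤ d → t ≡ X + L → t ∸ d ≤ X
∸-bound t L d X L≤d e = ≤-trans (∸-monoʳ-≤ t L≤d) (≤-reflexive (trans (cong (_∸ L) e) (m+n∸n≡m X L)))

length-blockBody : ∀ o a b en → length (blockBody o a b en) ≡ suc (a + b)
length-blockBody o a b en = begin
  length (down (o + suc b) a ++ en ∷ down (suc o) b)  ≡⟨ List.length-++ (down (o + suc b) a) ⟩
  length (down (o + suc b) a) + suc (length (down (suc o) b))  ≡⟨ cong₂ (λ k l → k + suc l) (length-down _ a) (length-down _ b) ⟩
  a + suc b                                          ≡⟨ +-suc a b ⟩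
  suc (a + b)                                        ∎
  where open ≡-Reasoning

module BlockWalks (W pre rest : List ℕ) (o x a b en : ℕ)
  (W≡ : W ≡ pre ++ (x ∷ (blockBody o a b en ++ rest))) (length-pre : length pre ≡ o) where
  open BlockSegment W pre rest o x a b en W≡ length-pre public
  open Zigzag W o 1 (suc (a + b)) a b upper↦lower lower↦upper

  walk-lower′ : ∀ d → 1 ≤ d → d ≤ b → d ≤ suc a → Walk W (o + d) (o + suc (a + b))
  walk-lower′ (suc k) _ p q = walk-lower k p (≤-pred q)

  walk-upper′ : ∀ d → d ≤ suc (a + b) → (suc (a + b) ∸ d) ≤ a → (suc (a + b) ∸ d) ≤ b → Walk W (o + d) (o + suc (a + b))
  walk-upper′ d d≤ p q = subst (λ z → Walk W (o + z) (o + suc (a + b))) (m∸[m∸n]≡n d≤) (walk-upper _ p q)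

  walk-block : (bt : BlockKind a b) → ∀ d → 1 ≤ d → d ≤ suc (a + b) → ¬ IsFixed bt d → Walk W (o + d) (o + suc (a + b))
  walk-block (a≡b refl) d 1≤ d≤ _ with d ≤? a
  ... | yes p = walk-lower′ d 1≤ p (≤-trans p (n≤1+n a))
  ... | no p = walk-upper′ d d≤ le le
    where le = ∸-bound (suc (a + a)) (suc a) d a (≰⇒> p) (sym (+-suc a a))
  walk-block (b≡1+a refl) d 1≤ d≤ _ with d ≤? suc a
  ... | yes p = walk-lower′ d 1≤ p p
  ... | no p = walk-upper′ d d≤ le (≤-trans le (n≤1+n a))
    where le = ∸-bound (suc (a + suc a)) (suc (suc a)) d a (≰⇒> p) (sym (+-suc a (suc a)))
  walk-block (a≡1+b refl) d 1≤ d≤ nfp with d ≤? b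
  ... | yes p = walk-lower′ d 1≤ p (≤-trans p (≤-trans (n≤1+n b) (n≤1+n (suc b))))
  ... | no p with d ≟ suc b
  ...   | yes e = ⊥-elim (nfp e)
  ...   | no ne = walk-upper′ d d≤ (≤-trans le (n≤1+n b)) le
    where le = ∸-bound (suc (suc b + b)) (suc (suc b)) d b (≤∧≢⇒< (≰⇒> p) (λ e → ne (sym e))) (sym (trans (+-suc b (suc b)) (cong suc (+-suc b b))))
  walk-block (b≡2+a refl) d 1≤ d≤ nfp with d ≤? suc a
  ... | yes p = walk-lower′ d 1≤ (≤-trans p (n≤1+n (suc a))) p
  ... | no p with d ≟ suc (suc a)
  ...   | yes e = ⊥-elim (nfp e)
  ...   | no ne = walk-upper′ d d≤ le (≤-trans le (≤-trans (n≤1+n a) (n≤1+n (suc a))))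
    where le = ∸-bound (suc (a + suc (suc a))) (suc (suc (suc a))) d a (≤∧≢⇒< (≰⇒> p) (λ e → ne (sym e))) (sym (+-suc a (suc (suc a))))

  isFixed-a≡1+b : a ≡ suc b → nth W (o + a) ≡ o + a
  isFixed-a≡1+b refl = trans (proj₂ (lower↦upper b ≤-refl)) (cong (o +_) (m+n∸n≡m (suc b) b))

  isFixed-b≡2+a : b ≡ suc (suc a) → nth W (o + suc (suc a)) ≡ o + suc (suc a)
  isFixed-b≡2+a refl = subst (λ z → nth W (o + z) ≡ o + suc (suc a)) (m+n∸m≡n a (suc (suc a))) (proj₂ (upper↦lower (suc a) ≤-refl))

module ColumnTail (W pre : List ℕ) (o x u v : ℕ)
  (W≡ : W ≡ pre ++ (down (o + v) u ++ x ∷ down o v)) (length-pre : length pre ≡ o) where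
  open Segment W pre (down (o + v) u ++ x ∷ down o v) o W≡ length-pre public

  length-tail : length (down (o + v) u ++ x ∷ down o v) ≡ u + suc v
  length-tail = trans (List.length-++ (down (o + v) u) {x ∷ down o v}) (cong₂ _+_ (length-down _ u) (cong suc (length-down o v)))

  inTail : ∀ d → d ≤ u + v → o + d < length W
  inTail d p = offset<length d (subst (d <_) (sym length-tail) (≤-trans (s≤s p) (≤-reflexive (sym (+-suc u v)))))

  lower↦upper : ∀ k → k < u → (o + (0 + k)) < length W × nth W (o + (0 + k)) ≡ o + (u + v ∸ suc k)
  lower↦upper k k<u with m≤n⇒∃[o]m+o≡n k<u
  ... | j , refl = inTail k (≤-trans (<⇒≤ k<u) (m≤m+n _ v)) ,
      trans (nth-offset k)
        (trans (nth-++ˡ (down (o + v) u) (x ∷ down o v) k (subst (k <_) (sym (length-down _ u)) k<u))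
          (trans (nth-down (o + v) k j)
            (trans (trans (+-assoc o v j) (cong (o +_) (+-comm v j)))
              (cong (o +_) (sym (trans (cong (_∸ k) (trans (+-assoc k j v) (+-comm k (j + v)))) (m+n∸n≡m (j + v) k)))))))

  upper↦lower : ∀ k → k < v → (o + (u + v ∸ k)) < length W × nth W (o + (u + v ∸ k)) ≡ o + (0 + k)
  upper↦lower k k<v with <⇒≡1+[+] k<v
  ... | i , refl = subst (λ z → (o + z) < length W × nth W (o + z) ≡ o + k) (sym posEq)
      (inTail (suc (u + i)) (≤-trans (≤-reflexive (sym (+-suc u i))) (+-monoʳ-≤ u (s≤s (m≤m+n i k)))) ,
       trans (cong (λ z → nth W (o + z)) (sym (+-suc u i)))
        (trans (nth-offset (u + suc i))
          (trans (cong (λ z → nth (down (o + v) u ++ x ∷ down o v) (z + suc i)) (sym (length-down (o + v) u)))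
            (trans (nth-++ʳ (down (o + v) u) (x ∷ down o v) (suc i))
              (nth-down o i k)))))
    where
      posEq : u + suc (i + k) ∸ k ≡ suc (u + i)
      posEq = trans (cong (_∸ k) (trans (+-suc u (i + k)) (cong suc (sym (+-assoc u i k))))) (m+n∸n≡m _ k)

  open Zigzag W o 0 (u + v) u v upper↦lower lower↦upper

  walk-column : (v ≡ u ⊎ v ≡ suc u) → ∀ d → d ≤ u + v → Walk W (o + d) (o + (u + v))
  walk-column (inj₁ refl) d d≤ with suc d ≤? u
  ... | yes p = walk-lower d p (<⇒≤ p)
  ... | no p = subst (λ z → Walk W (o + z) (o + (u + u))) (m∸[m∸n]≡n d≤) (walk-upper _ le le)
    where le = ∸-bound (u + u) u d u (≤-pred (≰⇒> p)) refl
  walk-column (inj₂ refl) d d≤ with d ≤? u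
  ... | yes p = walk-lower d (s≤s p) p
  ... | no p = subst (λ z → Walk W (o + z) (o + (u + suc u))) (m∸[m∸n]≡n d≤) (walk-upper _ le (≤-trans le (n≤1+n u)))
    where le = ∸-bound (u + suc u) (suc u) d u (≰⇒> p) refl

module SingletonsTail (W pre rest′ : List ℕ) (o x r : ℕ)
  (W≡ : W ≡ pre ++ (up (suc o) r ++ x ∷ rest′)) (length-pre : length pre ≡ o) where
  open Segment W pre (up (suc o) r ++ x ∷ rest′) o W≡ length-pre public

  length-tail : length (up (suc o) r ++ x ∷ rest′) ≡ r + suc (length rest′)
  length-tail = trans (List.length-++ (up (suc o) r) {x ∷ rest′}) (cong (_+ suc (length rest′)) (length-up _ r))

  inTail : ∀ d → d ≤ r → o + d < length W
  inTail d d≤r = offset<length d (subst (d <_) (sym length-tail) (≤-trans (s≤s d≤r) (≤-trans (s≤s (m≤m+n r _)) (≤-reflexive (sym (+-suc r _))))))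

  nth-start : nth W (o + r) ≡ x
  nth-start = trans (nth-offset r) (trans (cong (λ z → nth (up (suc o) r ++ x ∷ rest′) z) (sym (trans (cong (_+ 0) (length-up (suc o) r)) (+-identityʳ r))))
            (nth-++ʳ (up (suc o) r) (x ∷ rest′) 0))

  walk-singletons : ∀ d → d ≤ r → Walk W (o + d) (o + 0)
  walk-singletons zero _ = done
  walk-singletons (suc d) p with m≤n⇒∃[o]m+o≡n p
  ... | j , refl = bwd (inTail d (<⇒≤ p))
      (trans (nth-offset d) (trans (nth-++ˡ (up (suc o) (suc (d + j))) (x ∷ rest′) d (subst (d <_) (sym (length-up _ (suc (d + j)))) p))
        (trans (nth-up (suc o) d j) (sym (+-suc o d)))))
      (walk-singletons d (<⇒≤ p))

module TwoOneTail (W pre : List ℕ) (o x : ℕ)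
  (W≡ : W ≡ pre ++ (x ∷ o ∷ suc (suc o) ∷ [])) (length-pre : length pre ≡ o) where
  open Segment W pre (x ∷ o ∷ suc (suc o) ∷ []) o W≡ length-pre public
  inTwoOne : ∀ d → d ≤ 2 → o + d < length W
  inTwoOne d p = offset<length d (s≤s p)

Balanced : Block → Set
Balanced (a , b) = b ≡ a ⊎ b ≡ suc a

balancedKind : ∀ {a b} → Balanced (a , b) → BlockKind a b
balancedKind (inj₁ e) = a≡b e
balancedKind (inj₂ e) = b≡1+a e

balanced-unfixed : ∀ {a b} (m : Balanced (a , b)) d → ¬ IsFixed (balancedKind m) d
balanced-unfixed (inj₁ _) d ()
balanced-unfixed (inj₂ _) d ()

TailBalanced : Tail → Set
TailBalanced (column u v) = Balanced (u , v)
TailBalanced _ = ⊤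

FixedTail : Tail → Set
FixedTail (singletonsFixed _) = ⊤
FixedTail twoOne = ⊤
FixedTail _ = ⊥

length-split : ∀ (W pre S : List ℕ) o → W ≡ pre ++ S → length pre ≡ o → length W ≡ o + length S
length-split W pre S o refl refl = List.length-++ pre

<-segment : ∀ {W pre} S {o d} → W ≡ pre ++ S → length pre ≡ o → o + d < length W → d < length S
<-segment {W} {pre} S {o} {d} W≡ length-pre p = +-cancelˡ-< o d (length S) (subst (o + d <_) (length-split W pre S o W≡ length-pre) p)

walk-restWord : ∀ (W : List ℕ) (base : ℕ) pre x h bs tl → W ≡ pre ++ restWord x h bs tl → length pre ≡ x + h →
  All Balanced bs → TailBalanced tl → Walk W x base → Walk W (topOf (x + h) bs tl) base →
  ∀ d → (x + h) + d < length W → (FixedTail tl → (x + h) + d ≢ length W ∸ 1) → Walk W ((x + h) + d) base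
walk-restWord W base pre x h ((a , b) ∷ bs) tl W≡ length-pre (bal₁ ∷ bal) tailBal walkX walkTop d d< notLast = go d d< notLast
  where
    o = x + h
    c = height (a , b)
    en = topOf (o + c) bs tl
    open BlockWalks W pre (restWord o c bs tl) o x a b en W≡ length-pre
    walkStart : Walk W (o + 0) base
    walkStart = fwd (inBlock 0 z≤n) nth-start walkX
    walkInside : ∀ d → 1 ≤ d → d ≤ suc (a + b) → Walk W (o + d) base
    walkInside d p q = walk-block (balancedKind bal₁) d p q (balanced-unfixed bal₁ d) ++ʷ walkTop
    pre′ = pre ++ (x ∷ blockBody o a b en)
    W≡′ : W ≡ pre′ ++ restWord o c bs tl
    W≡′ = trans W≡ (sym (List.++-assoc pre (x ∷ blockBody o a b en) (restWord o c bs tl)))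
    length-pre′ : length pre′ ≡ o + c
    length-pre′ = trans (List.length-++ pre {x ∷ blockBody o a b en})
      (cong₂ _+_ length-pre (cong suc (length-blockBody o a b en)))
    walkO : Walk W o base
    walkO = subst (λ z → Walk W z base) (+-identityʳ o) walkStart
    walkEn : Walk W en base
    walkEn = bwd (inBlock (suc a) (s≤s (m≤m+n a b))) nth-slot done ++ʷ walkInside (suc a) (s≤s z≤n) (s≤s (m≤m+n a b))
    go : ∀ d → o + d < length W → (FixedTail tl → o + d ≢ length W ∸ 1) → Walk W (o + d) base
    go zero _ _ = walkStart
    go (suc d) p notLast with suc d ≤? suc (a + b)
    ... | yes q = walkInside (suc d) (s≤s z≤n) q
    ... | no q = subst (λ z → Walk W z base) posEq
        (walk-restWord W base pre′ o c bs tl W≡′ length-pre′ bal tailBal walkO walkEn (d ∸ suc (a + b))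
          (subst (_< length W) (sym posEq) p)
          (λ fixedTail e → notLast fixedTail (trans (sym posEq) e)))
      where
        posEq : o + c + (d ∸ suc (a + b)) ≡ o + suc d
        posEq = trans (+-assoc o c _) (cong (o +_) (cong suc (m+[n∸m]≡n (≤-pred (≰⇒> q)))))
walk-restWord W base pre x h [] (column u v) W≡ length-pre [] tailBal walkX walkTop d d< notLast =
  walk-column tailBal d (≤-pred (subst (d <_) (trans length-tail (+-suc u v)) (<-segment {W} {pre} (down (x + h + v) u ++ x ∷ down (x + h) v) W≡ length-pre d<)))
    ++ʷ walkTop
  where open ColumnTail W pre (x + h) x u v W≡ length-pre
walk-restWord W base pre x h [] (singletons r) W≡ length-pre [] tailBal walkX walkTop d d< notLast =
  walk-singletons d (≤-pred (subst (d <_) (trans length-tail (trans (+-suc r 0) (cong suc (+-identityʳ r))))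
    (<-segment {W} {pre} (up (suc (x + h)) r ++ x ∷ []) W≡ length-pre d<)))
    ++ʷ subst (λ z → Walk W z base) (sym (+-identityʳ (x + h))) walkTop
  where open SingletonsTail W pre [] (x + h) x r W≡ length-pre
walk-restWord W base pre x h [] (singletonsFixed r) W≡ length-pre [] tailBal walkX walkTop d d< notLast with d ≤? r
... | yes p = walk-singletons d p ++ʷ subst (λ z → Walk W z base) (sym (+-identityʳ (x + h))) walkTop
  where open SingletonsTail W pre (suc (x + h + r) ∷ []) (x + h) x r W≡ length-pre
... | no p = ⊥-elim (notLast _ (trans (cong ((x + h) +_) d≡) (sym lastEq)))
  where
    open SingletonsTail W pre (suc (x + h + r) ∷ []) (x + h) x r W≡ length-pre
    length≡ : length (up (suc (x + h)) r ++ x ∷ suc (x + h + r) ∷ []) ≡ suc (suc r)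
    length≡ = trans length-tail (trans (+-suc r 1) (cong suc (+-comm r 1)))
    d<′ : d < suc (suc r)
    d<′ = subst (d <_) length≡ (<-segment {W} {pre} (up (suc (x + h)) r ++ x ∷ suc (x + h + r) ∷ []) W≡ length-pre d<)
    d≡ : d ≡ suc r
    d≡ = ≤-antisym (≤-pred d<′) (≰⇒> p)
    lastEq : length W ∸ 1 ≡ (x + h) + suc r
    lastEq = trans (cong (_∸ 1) (trans (length-split W pre _ (x + h) W≡ length-pre) (cong ((x + h) +_) length≡)))
               (cong (_∸ 1) (+-suc (x + h) (suc r)))
walk-restWord W base pre x h [] twoOne W≡ length-pre [] tailBal walkX walkTop zero d< notLast =
  fwd (inTwoOne 0 z≤n) (nth-offset 0) walkX
  where open TwoOneTail W pre (x + h) x W≡ length-pre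
walk-restWord W base pre x h [] twoOne W≡ length-pre [] tailBal walkX walkTop (suc zero) d< notLast =
  subst (λ z → Walk W z base) (sym (trans (+-suc (x + h) 0) (cong suc (+-identityʳ (x + h))))) walkTop
walk-restWord W base pre x h [] twoOne W≡ length-pre [] tailBal walkX walkTop (suc (suc zero)) d< notLast =
  ⊥-elim (notLast _ (sym (trans (cong (_∸ 1) (length-split W pre _ (x + h) W≡ length-pre)) (cong (_∸ 1) (+-suc (x + h) 2)))))
walk-restWord W base pre x h [] twoOne W≡ length-pre [] tailBal walkX walkTop (suc (suc (suc d))) d< notLast =
  ⊥-elim (<⇒≱ (<-segment {W} {pre} (x ∷ (x + h) ∷ suc (suc (x + h)) ∷ []) W≡ length-pre d<) (s≤s (s≤s (s≤s z≤n))))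

slot-unfixed : ∀ {a b} (bt : BlockKind a b) → ¬ IsFixed bt (suc a)
slot-unfixed (a≡b _) ()
slot-unfixed (b≡1+a _) ()
slot-unfixed (a≡1+b _) e = 1+n≢n e
slot-unfixed (b≡2+a _) e = 1+n≢n (sym (suc-injective e))

walk-word : ∀ a b bs tl → (bt : BlockKind a b) → All Balanced bs → TailBalanced tl →
  ∀ d → d < length (word 0 ((a , b) ∷ bs) tl) → ¬ IsFixed bt d →
  (FixedTail tl → d ≢ length (word 0 ((a , b) ∷ bs) tl) ∸ 1) → Walk (word 0 ((a , b) ∷ bs) tl) d (suc (a + b))
walk-word a b bs tl bt bal tailBal = go
  where
    W = word 0 ((a , b) ∷ bs) tl
    c = height (a , b)
    en = topOf c bs tl
    top = suc (a + b)
    open BlockWalks W [] (restWord 0 c bs tl) 0 top a b en refl refl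
    walkStart : Walk W 0 top
    walkStart = fwd (inBlock 0 z≤n) nth-start done
    walkEn : Walk W en top
    walkEn = bwd (inBlock (suc a) (s≤s (m≤m+n a b))) nth-slot done ++ʷ walk-block bt (suc a) (s≤s z≤n) (s≤s (m≤m+n a b)) (slot-unfixed bt)
    go : ∀ d → d < length W → ¬ IsFixed bt d → (FixedTail tl → d ≢ length W ∸ 1) → Walk W d top
    go zero _ _ _ = walkStart
    go (suc d) p unfixed notLast with suc d ≤? suc (a + b)
    ... | yes q = walk-block bt (suc d) (s≤s z≤n) q unfixed
    ... | no q = subst (λ z → Walk W z top) posEq
        (walk-restWord W top (top ∷ blockBody 0 a b en) 0 c bs tl refl (cong suc (length-blockBody 0 a b en)) bal tailBal
          walkStart walkEn (d ∸ suc (a + b)) (subst (_< length W) (sym posEq) p)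
          (λ fixedTail e → notLast fixedTail (trans (sym posEq) e)))
      where
        posEq : c + (d ∸ suc (a + b)) ≡ suc d
        posEq = cong suc (m+[n∸m]≡n (≤-pred (≰⇒> q)))

restWord-tail : ∀ x h bs tl → Σ (List ℕ) λ pre → Σ ℕ λ x′ →
  restWord x h bs tl ≡ pre ++ tailWord (x + h + length pre) x′ tl
restWord-tail x h [] tl = [] , x , cong (λ z → tailWord z x tl) (sym (+-identityʳ (x + h)))
restWord-tail x h ((a , b) ∷ bs) tl with restWord-tail (x + h) (height (a , b)) bs tl
... | pre , x′ , e = (x ∷ blockBody o a b en ++ pre) , x′ ,
    trans (cong (λ z → x ∷ (blockBody o a b en ++ z)) e)
      (trans (cong (x ∷_) (sym (List.++-assoc (blockBody o a b en) pre _)))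
        (cong (λ z → (x ∷ blockBody o a b en ++ pre) ++ tailWord z x′ tl) posEq))
  where
    o = x + h
    en = topOf (o + height (a , b)) bs tl
    posEq : o + height (a , b) + length pre ≡ x + h + length (x ∷ blockBody o a b en ++ pre)
    posEq = trans (+-assoc o (height (a , b)) (length pre))
      (cong (o +_) (cong suc (sym (trans (List.length-++ (blockBody o a b en) {pre}) (cong (_+ length pre) (length-blockBody o a b en))))))

nth-last : ∀ ys z → nth (ys ++ z ∷ []) (length ys) ≡ z
nth-last [] z = refl
nth-last (y ∷ ys) z = nth-last ys z

record CycleWitness (W : List ℕ) : Set where
  field
    fixed    : ℕ
    fixed<   : fixed < length W
    isFixed  : nth W fixed ≡ fixed
    hub      : ℕ
    walkHub  : ∀ p → p < length W → p ≢ fixed → Walk W p hub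

nth-last-fixed : ∀ W Y z → W ≡ Y ++ z ∷ [] → z ≡ length Y → nth W (length W ∸ 1) ≡ length W ∸ 1
nth-last-fixed W Y z refl e rewrite List.length-++ Y {z ∷ []} | +-suc (length Y) 0 | +-identityʳ (length Y) =
  trans (nth-last Y z) e

witness-a≡1+b : ∀ a b bs tl → a ≡ suc b → All Balanced bs → TailBalanced tl → ¬ FixedTail tl →
  CycleWitness (word 0 ((a , b) ∷ bs) tl)
witness-a≡1+b a b bs tl e bal tailBal unfixedTail = record
  { fixed   = a
  ; fixed<  = inBlock a (≤-trans (m≤m+n a b) (n≤1+n _))
  ; isFixed = isFixed-a≡1+b e
  ; hub     = suc (a + b)
  ; walkHub = λ p p< p≢ → walk-word a b bs tl (a≡1+b e) bal tailBal p p< p≢ (λ t → ⊥-elim (unfixedTail t)) }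
  where open BlockWalks (word 0 ((a , b) ∷ bs) tl) [] (restWord 0 (height (a , b)) bs tl) 0 (suc (a + b)) a b (topOf (height (a , b)) bs tl) refl refl

witness-b≡2+a : ∀ a b bs tl → b ≡ suc (suc a) → All Balanced bs → TailBalanced tl → ¬ FixedTail tl →
  CycleWitness (word 0 ((a , b) ∷ bs) tl)
witness-b≡2+a a b bs tl e bal tailBal unfixedTail = record
  { fixed   = suc (suc a)
  ; fixed<  = inBlock (suc (suc a)) (s≤s (subst (λ z → suc a ≤ a + z) (sym e) (≤-trans (n≤1+n (suc a)) (m≤n+m (suc (suc a)) a))))
  ; isFixed = isFixed-b≡2+a e
  ; hub     = suc (a + b)
  ; walkHub = λ p p< p≢ → walk-word a b bs tl (b≡2+a e) bal tailBal p p< p≢ (λ t → ⊥-elim (unfixedTail t)) }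
  where
    open BlockWalks (word 0 ((a , b) ∷ bs) tl) [] (restWord 0 (height (a , b)) bs tl) 0 (suc (a + b)) a b (topOf (height (a , b)) bs tl) refl refl

witness-fixedTail : ∀ bs tl → All Balanced bs → TailBalanced tl → FixedTail tl → CycleWitness (word 0 ((0 , 0) ∷ bs) tl)
witness-fixedTail bs tl bal tailBal fixedTail = record
  { fixed   = length W ∸ 1
  ; fixed<  = s≤s ≤-refl
  ; isFixed = lastFixed tl fixedTail
  ; hub     = 1
  ; walkHub = λ p p< p≢ → walk-word 0 0 bs tl (a≡b refl) bal tailBal p p< (λ ()) (λ _ → p≢) }
  where
    W = word 0 ((0 , 0) ∷ bs) tl
    lastFixed : ∀ tl → FixedTail tl → let W = word 0 ((0 , 0) ∷ bs) tl in nth W (length W ∸ 1) ≡ length W ∸ 1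
    lastFixed (singletonsFixed r) _ with restWord-tail 0 2 bs (singletonsFixed r)
    ... | pre , x′ , e =
      nth-last-fixed (word 0 ((0 , 0) ∷ bs) (singletonsFixed r)) (1 ∷ topOf 2 bs (singletonsFixed r) ∷ (pre ++ up (suc o′) r ++ x′ ∷ [])) (suc (o′ + r))
        (cong (λ z → 1 ∷ topOf 2 bs (singletonsFixed r) ∷ z)
          (trans e (trans (sym (cong (pre ++_) (List.++-assoc (up (suc o′) r) (x′ ∷ []) (suc (o′ + r) ∷ []))))
            (sym (List.++-assoc pre (up (suc o′) r ++ x′ ∷ []) (suc (o′ + r) ∷ []))))))
        (trans (cong (λ m → suc (suc m)) (trans (sym (+-suc (length pre) r)) (cong (length pre +_) (+-comm 1 r)))) (cong (λ z → suc (suc z))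
          (sym (trans (List.length-++ pre {up (suc o′) r ++ x′ ∷ []})
            (cong (length pre +_) (trans (List.length-++ (up (suc o′) r) {x′ ∷ []}) (cong (_+ 1) (length-up _ r))))))))
      where
        o′ = suc (suc (length pre))
    lastFixed twoOne _ with restWord-tail 0 2 bs twoOne
    ... | pre , x′ , e =
      nth-last-fixed (word 0 ((0 , 0) ∷ bs) twoOne) (1 ∷ topOf 2 bs twoOne ∷ (pre ++ x′ ∷ o′ ∷ [])) (suc (suc o′))
        (cong (λ z → 1 ∷ topOf 2 bs twoOne ∷ z) (trans e (sym (List.++-assoc pre (x′ ∷ o′ ∷ []) (suc (suc o′) ∷ [])))))
        (trans (cong (λ m → suc (suc m)) (sym (+-comm (length pre) 2))) (cong (λ z → suc (suc z)) (sym (List.length-++ pre {x′ ∷ o′ ∷ []}))))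
      where
        o′ = suc (suc (length pre))

witness-twoOne : CycleWitness (word 0 [] twoOne)
witness-twoOne = record { fixed = 2 ; fixed< = s≤s (s≤s (s≤s z≤n)) ; isFixed = refl ; hub = 1 ; walkHub = walkToHub }
  where
    walkToHub : ∀ p → p < 3 → p ≢ 2 → Walk (1 ∷ 0 ∷ 2 ∷ []) p 1
    walkToHub zero _ _ = fwd (s≤s z≤n) refl done
    walkToHub (suc zero) _ _ = done
    walkToHub (suc (suc zero)) _ ne = ⊥-elim (ne refl)
    walkToHub (suc (suc (suc p))) (s≤s (s≤s (s≤s ()))) _

-- Choosing the columns

All-squeezed : ∀ {v} xs → All (v ≤_) xs → All (_≤ v) xs → xs ≡ replicate (length xs) v
All-squeezed []       _            _            = refl
All-squeezed (x ∷ xs) (v≤x ∷ v≤xs) (x≤v ∷ xs≤v) = cong₂ _∷_ (≤-antisym x≤v v≤x) (All-squeezed xs v≤xs xs≤v)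

splitOnes : ∀ c → All (1 ≤_) c → Nonincreasing c → Σ (List ℕ) λ T → Σ ℕ λ s →
  c ≡ T ++ replicate s 1 × All (2 ≤_) T × Nonincreasing T
splitOnes []       _          _  = [] , 0 , refl , [] , []
splitOnes (x ∷ xs) (1≤x ∷ 1≤xs) ni with 2 ≤? x
... | yes 2≤x with splitOnes xs 1≤xs (Linked.tail ni)
...   | T , s , xs≡ , 2≤T , niT =
  x ∷ T , s , cong (x ∷_) xs≡ , 2≤x ∷ 2≤T , Nonincreasing-∷ (++⁻ˡ T (subst (All (_≤ x)) xs≡ (Nonincreasing-All ni))) niT
splitOnes (x ∷ xs) (1≤x ∷ 1≤xs) ni | no 2≰x =
  [] , length (x ∷ xs) , All-squeezed (x ∷ xs) (1≤x ∷ 1≤xs) (x≤1 ∷ All.map (λ y≤x → ≤-trans y≤x x≤1) (Nonincreasing-All ni)) , [] , []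
  where
    x≤1 : x ≤ 1
    x≤1 = ≤-pred (≰⇒> 2≰x)

replicate-++-∷ : ∀ t (x : ℕ) L → replicate t x ++ x ∷ L ≡ x ∷ replicate t x ++ L
replicate-++-∷ zero    x L = refl
replicate-++-∷ (suc t) x L = cong (x ∷_) (replicate-++-∷ t x L)

halve : ℕ → ℕ × ℕ
halve zero          = 0 , 0
halve (suc zero)    = 0 , 1
halve (suc (suc m)) = suc (proj₁ (halve m)) , suc (proj₂ (halve m))

halve-sum : ∀ m → proj₁ (halve m) + proj₂ (halve m) ≡ m
halve-sum zero          = refl
halve-sum (suc zero)    = refl
halve-sum (suc (suc m)) = cong suc (trans (+-suc (proj₁ (halve m)) (proj₂ (halve m))) (cong suc (halve-sum m)))

halve-balanced : ∀ m → Balanced (halve m)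
halve-balanced zero          = inj₁ refl
halve-balanced (suc zero)    = inj₂ refl
halve-balanced (suc (suc m)) with halve-balanced m
... | inj₁ eq = inj₁ (cong suc eq)
... | inj₂ eq = inj₂ (cong suc eq)

halve-positive : ∀ m → 1 ≤ m → 1 ≤ proj₂ (halve m)
halve-positive (suc zero)    _ = s≤s z≤n
halve-positive (suc (suc m)) _ = s≤s z≤n

height-halve : ∀ m → height (halve m) ≡ suc (suc m)
height-halve m = cong (λ k → suc (suc k)) (halve-sum m)

-- A block of height 3 + m with a fixed point: (1 + b , b) for even m, (a , 2 + a) for odd m.
fixingBlock : ℕ → Block
fixingBlock zero          = 1 , 0
fixingBlock (suc zero)    = 0 , 2
fixingBlock (suc (suc m)) = suc (proj₁ (fixingBlock m)) , suc (proj₂ (fixingBlock m))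

height-fixingBlock : ∀ m → height (fixingBlock m) ≡ suc (suc (suc m))
height-fixingBlock zero          = refl
height-fixingBlock (suc zero)    = refl
height-fixingBlock (suc (suc m)) = cong (λ k → suc (suc k))
  (trans (cong suc (+-suc (proj₁ (fixingBlock m)) (proj₂ (fixingBlock m))))
         (cong suc (cong suc (suc-injective (suc-injective (height-fixingBlock m))))))

witness-fixingBlock : ∀ m bs tl → All Balanced bs → TailBalanced tl → ¬ FixedTail tl →
  CycleWitness (word 0 (fixingBlock m ∷ bs) tl)
witness-fixingBlock m bs tl = witness (shape m)
  where
    shape : ∀ m → proj₁ (fixingBlock m) ≡ suc (proj₂ (fixingBlock m)) ⊎ proj₂ (fixingBlock m) ≡ suc (suc (proj₁ (fixingBlock m)))
    shape zero          = inj₁ refl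
    shape (suc zero)    = inj₂ refl
    shape (suc (suc m)) with shape m
    ... | inj₁ eq = inj₁ (cong suc eq)
    ... | inj₂ eq = inj₂ (cong suc eq)
    witness : _ → All Balanced bs → TailBalanced tl → ¬ FixedTail tl → CycleWitness (word 0 (fixingBlock m ∷ bs) tl)
    witness (inj₁ eq) = witness-a≡1+b _ _ bs tl eq
    witness (inj₂ eq) = witness-b≡2+a _ _ bs tl eq

fitsAfter-nonColumn : ∀ p bs tl → (∀ u v → tl ≢ column u v) → FitsAfter p bs tl
fitsAfter-nonColumn p []        (column u v)        ≢column = ⊥-elim (≢column u v refl)
fitsAfter-nonColumn p []        (singletons r)      _       = tt
fitsAfter-nonColumn p []        (singletonsFixed r) _       = tt
fitsAfter-nonColumn p []        twoOne              _       = tt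
fitsAfter-nonColumn p (bk ∷ bs) tl                  ≢column = fitsAfter-nonColumn (height bk) bs tl ≢column

-- The columns after the first one, arranged without a fixed point; p is the height of the first column.
record FixedPointFree (p : ℕ) (hs : List ℕ) : Set where
  field
    blocks       : List Block
    tail         : Tail
    fits         : FitsAfter p blocks tail
    heights≡     : heights blocks tail ≡ hs
    balanced     : All Balanced blocks
    tailBalanced : TailBalanced tail
    tailUnfixed  : ¬ FixedTail tail

fixedPointFree-columns : ∀ {p y ys} → All (2 ≤_) (y ∷ ys) → Nonincreasing (y ∷ ys) → y ≤ p →
  FixedPointFree p (y ∷ ys)
fixedPointFree-columns {p} {suc y} {[]} (s≤s 1≤y ∷ []) _ y<p = record
  { blocks = [] ; tail = column u (proj₂ (halve y))
  ; fits = ≤-trans (s≤s u<y) y<p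
  ; heights≡ = cong (λ k → suc k ∷ []) (halve-sum y)
  ; balanced = [] ; tailBalanced = halve-balanced y ; tailUnfixed = λ () }
  where
    u = proj₁ (halve y)
    u<y : u < y
    u<y = subst (u <_) (halve-sum y) (subst (_≤ u + proj₂ (halve y)) (+-comm u 1) (+-monoʳ-≤ u (halve-positive y 1≤y)))
fixedPointFree-columns {p} {suc (suc y)} {z ∷ zs} (_ ∷ 2≤z∷zs) (z≤ ∷ ni) _ = record
  { blocks = halve y ∷ blocks ; tail = tail
  ; fits = subst (λ q → FitsAfter q blocks tail) (sym (height-halve y)) fits
  ; heights≡ = cong₂ _∷_ (height-halve y) heights≡
  ; balanced = halve-balanced y ∷ balanced ; tailBalanced = tailBalanced ; tailUnfixed = tailUnfixed }
  where open FixedPointFree (fixedPointFree-columns 2≤z∷zs ni z≤)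
fixedPointFree-columns {y = suc zero} {_ ∷ _} (s≤s () ∷ _) _ _

fixedPointFree-singletons : ∀ p T s → All (2 ≤_) T → FixedPointFree p (T ++ replicate (suc s) 1)
fixedPointFree-singletons p T s 2≤T = record
  { blocks = map (λ y → halve (y ∸ 2)) T ; tail = singletons s
  ; fits = fitsAfter-nonColumn p (map (λ y → halve (y ∸ 2)) T) (singletons s) (λ _ _ ())
  ; heights≡ = heights-halves T 2≤T
  ; balanced = balanced-halves T ; tailBalanced = tt ; tailUnfixed = λ () }
  where
    heights-halves : ∀ T → All (2 ≤_) T → heights (map (λ y → halve (y ∸ 2)) T) (singletons s) ≡ T ++ replicate (suc s) 1
    heights-halves []                _            = refl
    heights-halves (suc (suc y) ∷ T) (_ ∷ 2≤T)   = cong₂ _∷_ (height-halve y) (heights-halves T 2≤T)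
    heights-halves (suc zero ∷ T)    (s≤s () ∷ _)
    balanced-halves : ∀ T → All Balanced (map (λ y → halve (y ∸ 2)) T)
    balanced-halves []      = []
    balanced-halves (y ∷ T) = halve-balanced (y ∸ 2) ∷ balanced-halves T

Arrangement : List ℕ → Set
Arrangement hs = Σ (List Block) λ bs → Σ Tail λ tl → Fits bs tl × heights bs tl ≡ hs × CycleWitness (word 0 bs tl)

arrangement-fixingBlock : ∀ m {hs} → FixedPointFree (suc (suc (suc m))) hs → Arrangement (suc (suc (suc m)) ∷ hs)
arrangement-fixingBlock m rest =
  fixingBlock m ∷ blocks , tail ,
  subst (λ q → FitsAfter q blocks tail) (sym (height-fixingBlock m)) fits ,
  cong₂ _∷_ (height-fixingBlock m) heights≡ ,
  witness-fixingBlock m blocks tail balanced tailBalanced tailUnfixed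
  where open FixedPointFree rest

heights-replicate : ∀ t tl → heights (replicate t (0 , 0)) tl ≡ replicate t 2 ++ heights [] tl
heights-replicate zero    tl = refl
heights-replicate (suc t) tl = cong (2 ∷_) (heights-replicate t tl)

-- All blocks are (0 , 0); the fixed point is the last entry of the tail.
arrangement-twos : ∀ t s → Arrangement (replicate (suc t) 2 ++ replicate (suc s) 1)
arrangement-twos zero    zero    = [] , twoOne , tt , refl , witness-twoOne
arrangement-twos (suc t) zero    =
  (0 , 0) ∷ replicate t (0 , 0) , twoOne , fitsAfter-nonColumn 2 (replicate t (0 , 0)) twoOne (λ _ _ ()) ,
  cong (2 ∷_) (trans (heights-replicate t twoOne) (replicate-++-∷ t 2 (1 ∷ []))) ,
  witness-fixedTail (replicate t (0 , 0)) twoOne (replicate⁺ t (inj₁ refl)) tt tt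
arrangement-twos t       (suc s) =
  (0 , 0) ∷ replicate t (0 , 0) , singletonsFixed s , fitsAfter-nonColumn 2 (replicate t (0 , 0)) (singletonsFixed s) (λ _ _ ()) ,
  cong (2 ∷_) (heights-replicate t (singletonsFixed s)) ,
  witness-fixedTail (replicate t (0 , 0)) (singletonsFixed s) (replicate⁺ t (inj₁ refl)) tt tt

arrangement : ∀ {n} λ′ → IsPartition n λ′ → 1 ≤ n → λ′ ≢ n ∷ [] → λ′ ≢ replicate n 1 →
  (∀ t → λ′ ≢ t ∷ t ∷ []) → Arrangement (conjugate λ′)
arrangement {n} λ′ (positive , ni , sum≡n) 1≤n ≢[n] ≢1ⁿ ≢[t,t] =
  fromSplit (splitOnes c (positive-conjugate λ′) (Nonincreasing-conjugate λ′))
  where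
    c = conjugate λ′
    λ′≡ : ∀ {hs} → c ≡ hs → λ′ ≡ conjugate hs
    λ′≡ c≡ = trans (sym (conjugate-involutive λ′ positive ni)) (cong conjugate c≡)
    sum-hs : ∀ {hs} → c ≡ hs → sum hs ≡ n
    sum-hs c≡ = trans (cong sum (sym c≡)) (trans (sum-conjugate λ′) sum≡n)

    twos : ∀ t s → c ≡ replicate (suc t) 2 ++ replicate s 1 → Arrangement c
    twos t zero    c≡ = ⊥-elim (≢[t,t] (suc t) (trans (λ′≡ (trans c≡ (List.++-identityʳ _))) (conjugate-replicate-2 t)))
    twos t (suc s) c≡ = subst Arrangement (sym c≡) (arrangement-twos t s)

    tall : ∀ x → 3 ≤ x → ∀ T s → c ≡ x ∷ T ++ replicate s 1 → All (2 ≤_) T → Nonincreasing (x ∷ T) → Arrangement c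
    tall 0 () _ _ _ _ _
    tall 1 (s≤s ()) _ _ _ _ _
    tall 2 (s≤s (s≤s ())) _ _ _ _ _
    tall (suc (suc (suc m))) _ []       zero    c≡ _   _  =
      ⊥-elim (≢1ⁿ (trans (λ′≡ c≡) (trans conjugate-[ 3 + m ] (cong (λ k → replicate k 1) (trans (sym (+-identityʳ _)) (sum-hs c≡))))))
    tall (suc (suc (suc m))) _ (y ∷ ys) zero    c≡ 2≤T ni =
      subst Arrangement (sym (trans c≡ (cong (3 + m ∷_) (List.++-identityʳ (y ∷ ys)))))
        (arrangement-fixingBlock m (fixedPointFree-columns 2≤T (Linked.tail ni) (All.head (Nonincreasing-All ni))))
    tall (suc (suc (suc m))) _ T        (suc s) c≡ 2≤T _  =
      subst Arrangement (sym c≡) (arrangement-fixingBlock m (fixedPointFree-singletons _ T s 2≤T))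

    fromSplit : (Σ (List ℕ) λ T → Σ ℕ λ s → c ≡ T ++ replicate s 1 × All (2 ≤_) T × Nonincreasing T) → Arrangement c
    fromSplit ([] , zero , c≡ , _) = ⊥-elim (<⇒≢ 1≤n (sum-hs c≡))
    fromSplit ([] , suc s , c≡ , _) =
      ⊥-elim (≢[n] (trans (λ′≡ c≡) (trans (conjugate-replicate-1 s) (cong (_∷ []) (trans (sym (sum-replicate-1 (suc s))) (sum-hs c≡))))))
    fromSplit (x ∷ T , s , c≡ , 2≤x ∷ 2≤T , niT) with x ≤? 2
    ... | yes x≤2 = twos (length T) s (trans c≡ (cong (_++ replicate s 1)
                      (All-squeezed (x ∷ T) (2≤x ∷ 2≤T) (x≤2 ∷ All.map (λ y≤x → ≤-trans y≤x x≤2) (Nonincreasing-All niT)))))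
    ... | no x≰2  = tall x (≰⇒> x≰2) T s c≡ 2≤T niT

realise : ∀ {n λ′} → IsPartition n λ′ → Arrangement (conjugate λ′) →
  ∃ λ (σ : Permutation′ n) → AlmostCyclic σ × Γ (P (oneLine σ)) ≡ λ′
realise {n} {λ′} (positive , ni , sum≡n) (bs , tl , fits , heights≡ , witness) = σ , almostCyclic , shape
  where
    open CycleWitness witness
    W = word 0 bs tl
    W↭ : W ↭ upTo n
    W↭ = subst (λ m → W ↭ upTo m) (trans (cong sum heights≡) (trans (sum-conjugate λ′) sum≡n)) (word↭upTo bs tl fits)
    σ = wordPermutation W↭
    toLength : ∀ {p} → p < n → p < length W
    toLength = subst (_ <_) (sym (length-word W↭))
    almostCyclic : AlmostCyclic σ
    almostCyclic = wordPermutation-almostCyclic W↭ (subst (_ <_) (length-word W↭) fixed<) isFixed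
                     (λ p p< p≢ → walkHub p (toLength p<) p≢)
    shape : Γ (P (oneLine σ)) ≡ λ′
    shape = begin
      Γ (P (oneLine σ))                          ≡⟨ cong (λ w → Γ (P w)) (oneLine-wordPermutation W↭) ⟩
      Γ (P (map suc W))                          ≡⟨ cong (λ w → Γ (P w)) (map-suc-word 0 bs tl) ⟩
      Γ (P (word 1 bs tl))                       ≡⟨ cong Γ (P-word 1 bs tl fits) ⟩
      Γ (fromColumns (columns 1 bs tl))          ≡⟨ shape-fromColumns (columns 1 bs tl) ⟩
      conjugate (map length (columns 1 bs tl))   ≡⟨ cong conjugate (trans (map-length-columns 1 bs tl) heights≡) ⟩
      conjugate (conjugate λ′)                   ≡⟨ conjugate-involutive λ′ positive ni ⟩
      λ′                                         ∎
      where open ≡-Reasoning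

realisable : ∀ {n} λ′ → IsPartition n λ′ → 1 ≤ n → λ′ ≢ n ∷ [] → λ′ ≢ replicate n 1 → (∀ t → λ′ ≢ t ∷ t ∷ []) →
  ∃ λ (σ : Permutation′ n) → AlmostCyclic σ × Γ (P (oneLine σ)) ≡ λ′
realisable λ′ partition 1≤n ≢[n] ≢1ⁿ ≢[t,t] = realise partition (arrangement λ′ partition 1≤n ≢[n] ≢1ⁿ ≢[t,t])

theorem4p2 : ∀ (n : ℕ) → 1 ≤ n →
    (∀ (k : ℕ) → n ≡ 1 + 2 * k →
    ∀ (λ′ : List ℕ) → IsPartition n λ′ →
    λ′ ≢ n ∷ [] → λ′ ≢ replicate n 1 →
    ∃ λ (σ : Permutation′ n) → AlmostCyclic σ × Γ (P (oneLine σ)) ≡ λ′)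
    ×
    (∀ (k : ℕ) → n ≡ 2 * k →
    ∀ (λ′ : List ℕ) → IsPartition n λ′ →
    λ′ ≢ n ∷ [] → λ′ ≢ replicate n 1 → λ′ ≢ k ∷ k ∷ [] →
    ∃ λ (σ : Permutation′ n) → AlmostCyclic σ × Γ (P (oneLine σ)) ≡ λ′)
theorem4p2 n 1≤n = whenOdd , whenEven
  where
    2t≡n : ∀ {λ′ t} → IsPartition n λ′ → λ′ ≡ t ∷ t ∷ [] → 2 * t ≡ n
    2t≡n (_ , _ , sum≡n) refl = sum≡n
    whenOdd : ∀ k → n ≡ 1 + 2 * k → ∀ λ′ → IsPartition n λ′ → λ′ ≢ n ∷ [] → λ′ ≢ replicate n 1 →
      ∃ λ (σ : Permutation′ n) → AlmostCyclic σ × Γ (P (oneLine σ)) ≡ λ′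
    whenOdd k n≡1+2k λ′ partition ≢[n] ≢1ⁿ = realisable λ′ partition 1≤n ≢[n] ≢1ⁿ
      λ t λ′≡[t,t] → even≢odd t k (trans (2t≡n partition λ′≡[t,t]) n≡1+2k)
    whenEven : ∀ k → n ≡ 2 * k → ∀ λ′ → IsPartition n λ′ → λ′ ≢ n ∷ [] → λ′ ≢ replicate n 1 → λ′ ≢ k ∷ k ∷ [] →
      ∃ λ (σ : Permutation′ n) → AlmostCyclic σ × Γ (P (oneLine σ)) ≡ λ′
    whenEven k n≡2k λ′ partition ≢[n] ≢1ⁿ ≢[k,k] = realisable λ′ partition 1≤n ≢[n] ≢1ⁿ
      λ t λ′≡[t,t] → ≢[k,k] (trans λ′≡[t,t] (cong (λ m → m ∷ m ∷ []) (*-cancelˡ-≡ t k 2 (trans (2t≡n partition λ′≡[t,t]) n≡2k))))
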